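{- For all $n\ge3$, $$\mathscr{R}_{n+1}(z)=(4z+1)\mathscr{R}_{n}(z)+16z^2\mathscr{R}_{n-1}(z)+2^{n}z^2\mathscr{L}_{n-1}(z),$$ and $\mathscr{R}_2(z)=4z^2+3z+1$, $\mathscr{R}_3(z)=28z^3+28z^2+7z+1$.
   Context: For $m\ge1$, $X=(x_1,\dots,x_m)\in GF(2)^m$, $Y=(y_1,\dots,y_{m-1})\in GF(2)^{m-1}$, let $M_m^{X,Y}$ be the symmetric tridiagonal $m\times m$ matrix over $GF(2)$ with diagonal $x_1,\dots,x_m$ and $(j,j+1)$, $(j+1,j)$ entries $y_j$; $\mathscr{L}_m(z)=\sum_j D_m(j)z^j$ where $D_m(j)$ is the number of pairs $(X,Y)$ with $\operatorname{rank}M_m^{X,Y}=j$. For $n\ge1$, $X=(x_0,\dots,x_n)\in GF(2)^{n+1}$, $Y=(y_1,\dots,y_{n-1})\in GF(2)^{n-1}$, $Z=(z_1,\dots,z_n)\in GF(2)^n$, let $M_{n+1}^{X,Y,Z}$ be the symmetric $(n+1)\times(n+1)$ matrix over $GF(2)$ with rows/columns indexed $0,\dots,n$, diagonal entries $x_0,\dots,x_n$, $(0,k)$ and $(k,0)$ entries $z_k$ ($1\le k\le n$), $(j,j+1)$ and $(j+1,j)$ entries $y_j$ ($1\le j\le n-1$), and all other entries $0$. Then $\mathscr{R}_{n+1}(z)=\sum_j C_{n+1}(j)z^j$, where $C_{n+1}(j)$ is the number of triples $(X,Y,Z)$ with $\operatorname{rank}M_{n+1}^{X,Y,Z}=j$.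 -}

module Defs where

open import Data.Bool using (Bool; true; false; _∧_; _∨_; _xor_; not; if_then_else_)
open import Data.Nat using (ℕ; zero; suc; _+_; _*_; _∸_; _^_; _≡ᵇ_; _⊔_)
open import Data.Fin using (Fin; toℕ) renaming (zero to fzero; suc to fsuc)
open import Data.List using (List; []; _∷_; map; concatMap; foldr)

-- GF(2) is modelled by Bool (addition = xor, multiplication = ∧).
-- Vectors over GF(2) of length n are functions Fin n → Bool,
-- m×m matrices are functions Fin m → Fin m → Bool.

Bits : ℕ → Set
Bits n = Fin n → Bool

Mat : ℕ → Set
Mat m = Fin m → Fin m → Bool

allBits : (n : ℕ) → List (Bits n)
allBits zero = (λ ()) ∷ []
allBits (suc n) = concatMap (λ v → cons false v ∷ cons true v ∷ []) (allBits n)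
  where
  cons : Bool → Bits n → Bits (suc n)
  cons b v fzero = b
  cons b v (fsuc i) = v i

anyFin : (n : ℕ) → (Fin n → Bool) → Bool
anyFin zero f = false
anyFin (suc n) f = f fzero ∨ anyFin n (λ i → f (fsuc i))

allFinB : (n : ℕ) → (Fin n → Bool) → Bool
allFinB n f = not (anyFin n (λ i → not (f i)))

xorFin : (n : ℕ) → (Fin n → Bool) → Bool
xorFin zero f = false
xorFin (suc n) f = f fzero xor xorFin n (λ i → f (fsuc i))

allL : {A : Set} → (A → Bool) → List A → Bool
allL p = foldr (λ a b → p a ∧ b) true

card : (m : ℕ) → Bits m → ℕ
card zero S = 0
card (suc m) S = (if S fzero then 1 else 0) + card m (λ i → S (fsuc i))

sumL : {A : Set} → (A → ℕ) → List A → ℕ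
sumL f = foldr (λ a n → f a + n) 0

count : {A : Set} → (A → Bool) → List A → ℕ
count p = foldr (λ a n → (if p a then 1 else 0) + n) 0

rowSum : {m : ℕ} → Mat m → Bits m → Bits m
rowSum {m} M T j = xorFin m (λ i → T i ∧ M i j)

subsetB : {m : ℕ} → Bits m → Bits m → Bool
subsetB {m} T S = allFinB m (λ i → not (T i) ∨ S i)

independentRows : {m : ℕ} → Mat m → Bits m → Bool
independentRows {m} M S =
  allL (λ T → not (subsetB T S ∧ anyFin m T) ∨ anyFin m (rowSum M T)) (allBits m)

rank : {m : ℕ} → Mat m → ℕ
rank {m} M =
  foldr (λ S r → (if independentRows M S then card m S else 0) ⊔ r) 0 (allBits m)

-- Polynomials with natural coefficients, as coefficient sequences.

Poly : Set
Poly = ℕ → ℕ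

_≈P_ : Poly → Poly → Set
p ≈P q = ∀ j → p j ≡ q j
  where open import Relation.Binary.PropositionalEquality using (_≡_)

infix 4 _≈P_
infixl 6 _⊕_
infixr 7 _·_

_⊕_ : Poly → Poly → Poly
(p ⊕ q) j = p j + q j

_·_ : ℕ → Poly → Poly
(c · p) j = c * p j

zP : Poly → Poly
zP p zero = 0
zP p (suc j) = p j

fromCoeffs : List ℕ → Poly
fromCoeffs [] j = 0
fromCoeffs (a ∷ as) zero = a
fromCoeffs (a ∷ as) (suc j) = fromCoeffs as j

-- Partial lookup into a bit vector by a natural-number index
-- (false when out of range; only used in range below).

at : {k : ℕ} → Bits k → ℕ → Bool
at {zero} v i = false
at {suc k} v zero = v fzero
at {suc k} v (suc i) = at (λ t → v (fsuc t)) i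

-- The symmetric tridiagonal matrix M_m^{X,Y}:
-- X = (x_1..x_m) stored at positions 0..m-1,
-- Y = (y_1..y_{m-1}) stored at positions 0..m-2.
-- Rows/columns 0..m-1 (row i+1 of the paper is index i).

triMat : (m : ℕ) → Bits m → Bits (m ∸ 1) → Mat m
triMat m X Y i j with toℕ i | toℕ j
... | a | b =
  if a ≡ᵇ b then X i
  else if b ≡ᵇ suc a then at Y a
  else if a ≡ᵇ suc b then at Y b
  else false

Dcount : (m : ℕ) → ℕ → ℕ
Dcount m r =
  sumL (λ Y → count (λ X → rank (triMat m X Y) ≡ᵇ r) (allBits m)) (allBits (m ∸ 1))

Lpoly : ℕ → Poly
Lpoly m = Dcount m

-- The matrix M_{n+1}^{X,Y,Z}, given here for size s = n+1:
-- rows/columns indexed 0..n (exactly as in the paper),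
-- X = (x_0..x_n) at positions 0..n,
-- Y = (y_1..y_{n-1}) at positions 0..n-2 (y_k at position k-1),
-- Z = (z_1..z_n) at positions 0..n-1 (z_k at position k-1).

arrowMat : (s : ℕ) → Bits s → Bits (s ∸ 2) → Bits (s ∸ 1) → Mat s
arrowMat s X Y Z i j with toℕ i | toℕ j
... | zero | zero = X i
... | zero | suc b = at Z b
... | suc a | zero = at Z a
... | suc a | suc b =
  if a ≡ᵇ b then X i
  else if b ≡ᵇ suc a then at Y a
  else if a ≡ᵇ suc b then at Y b
  else false

-- C_s(j) and 𝓡_s(z)  (s = n+1 in the paper's notation)
Ccount : (s : ℕ) → ℕ → ℕ
Ccount s r =
  sumL (λ Z → sumL (λ Y → count (λ X → rank (arrowMat s X Y Z) ≡ᵇ r)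
    (allBits s)) (allBits (s ∸ 2))) (allBits (s ∸ 1))

Rpoly : ℕ → Poly
Rpoly s = Ccount s

module Submission where

-- The arrow matrix of size n+1 is then classified by the three entries
-- x_n, y, z_n of its last row: if all vanish the rank is that of the leading
-- block; if x_n = 1 one elimination leaves an arrow matrix of size n with
-- three entries toggled; the three remaining cases take two eliminations and
-- leave an arrow matrix of size n-1 (possibly with two entries toggled) or a
-- tridiagonal matrix of size n-1.  Summing over all entries, split along the
-- last coordinates, and using that toggling a coordinate permutes GF(2)^k
-- and that every coordinate the smaller matrix does not read contributes a
-- factor 2, the eight cases add up to the recurrence.

open import Defs
open import Data.Bool using (Bool; true; false; _∧_; _∨_; _xor_; not; if_then_else_; T)
open import Data.Bool.Properties
  using (∧-assoc; ∧-zeroʳ; ∧-identityʳ; ∧-distribʳ-xor; ∧-distribˡ-xor; xor-identityʳ; xor-same;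
         not-injective; ∧-idem; ∧-comm; if-eta; if-cong; if-cong-then; ∨-conicalˡ; ∨-conicalʳ; ∧-conicalˡ; ∧-conicalʳ)
open import Data.Bool.Solver using (module xor-∧-Solver)
open import Data.Nat using (ℕ; zero; suc; _+_; _*_; _∸_; _^_; _≡ᵇ_; _⊔_; _≤_; _<_; z≤n; s≤s)
open import Data.Nat.Properties
  using (≤-refl; ≤-reflexive; ≤-trans; ≤-antisym; ⊔-sel; m≤m⊔n; m≤n⊔m; +-monoʳ-≤; n≤1+n; n<1+n; m<n⇒m<1+n; m<1+n⇒m<n∨m≡n; <-irrefl; ≤-pred; <⇒≢; _≟_; ≡ᵇ⇒≡; suc-injective;
         +-identityʳ; +-assoc; +-comm; *-zeroʳ; *-distribˡ-+; +-commutativeSemigroup)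
open import Data.Nat.Tactic.RingSolver using (solve-∀)
open import Algebra.Properties.CommutativeSemigroup +-commutativeSemigroup
  using () renaming (interchange to +-interchange; x∙yz≈y∙xz to +-swapˡ)
open import Data.Fin using (Fin; toℕ; fromℕ; fromℕ<; punchIn; punchOut) renaming (zero to fzero; suc to fsuc)
open import Data.Fin.Properties using (punchIn-punchOut; toℕ<n; toℕ-fromℕ; toℕ-fromℕ<) renaming (_≟_ to _≟F_)
open import Data.Vec.Functional using (insertAt; removeAt)
open import Data.Vec.Functional.Properties using (insertAt-lookup; insertAt-punchIn)
open import Data.List using (List; []; _∷_; _++_; foldr; concatMap)
open import Data.List.Relation.Unary.Any using (Any; here; there)
import Data.List.Relation.Unary.Any as Any
open import Data.List.Relation.Unary.Any.Properties using (concatMap⁺)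
open import Data.Product using (Σ; _×_; _,_)
open import Data.Sum using (_⊎_; inj₁; inj₂)
open import Data.Empty using (⊥-elim)
open import Relation.Nullary using (yes; no)
open import Relation.Nullary.Decidable using (dec-true; dec-false)
open import Data.Unit using (tt)
open import Relation.Binary.PropositionalEquality

-- Vectors over GF(2)

IsZero : {n : ℕ} → Bits n → Set
IsZero v = ∀ i → v i ≡ false

_⊆_ : {n : ℕ} → Bits n → Bits n → Set
T ⊆ S = ∀ i → T i ≡ true → S i ≡ true

bit : Bool → ℕ
bit b = if b then 1 else 0

true≢false : true ≢ false
true≢false ()

anyFin-cong : (n : ℕ) {v w : Bits n} → v ≗ w → anyFin n v ≡ anyFin n w
anyFin-cong zero e = refl
anyFin-cong (suc n) e = cong₂ _∨_ (e fzero) (anyFin-cong n (λ i → e (fsuc i)))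

xorFin-cong : (n : ℕ) {v w : Bits n} → v ≗ w → xorFin n v ≡ xorFin n w
xorFin-cong zero e = refl
xorFin-cong (suc n) e = cong₂ _xor_ (e fzero) (xorFin-cong n (λ i → e (fsuc i)))

card-cong : (n : ℕ) {v w : Bits n} → v ≗ w → card n v ≡ card n w
card-cong zero e = refl
card-cong (suc n) e = cong₂ (λ b c → bit b + c) (e fzero) (card-cong n (λ i → e (fsuc i)))

anyFin-false⇒IsZero : (n : ℕ) (v : Bits n) → anyFin n v ≡ false → IsZero v
anyFin-false⇒IsZero (suc n) v e fzero = ∨-conicalˡ _ _ e
anyFin-false⇒IsZero (suc n) v e (fsuc i) =
  anyFin-false⇒IsZero n (λ i → v (fsuc i)) (∨-conicalʳ _ _ e) i

IsZero⇒anyFin-false : (n : ℕ) (v : Bits n) → IsZero v → anyFin n v ≡ false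
IsZero⇒anyFin-false zero v z = refl
IsZero⇒anyFin-false (suc n) v z =
  cong₂ _∨_ (z fzero) (IsZero⇒anyFin-false n (λ i → v (fsuc i)) (λ i → z (fsuc i)))

anyFin-true⇒witness : (n : ℕ) (v : Bits n) → anyFin n v ≡ true → Σ (Fin n) (λ t → v t ≡ true)
anyFin-true⇒witness (suc n) v e with v fzero in eq
... | true = fzero , eq
... | false with anyFin-true⇒witness n (λ i → v (fsuc i)) e
...   | t , vt = fsuc t , vt

subsetB⇒⊆ : {n : ℕ} {T S : Bits n} → subsetB T S ≡ true → T ⊆ S
subsetB⇒⊆ {n} {T} {S} e i Ti =
  not-injective (subst (λ b → not (not b ∨ S i) ≡ false) Ti
                       (anyFin-false⇒IsZero n _ (not-injective e) i))

⊆⇒subsetB : {n : ℕ} {T S : Bits n} → T ⊆ S → subsetB T S ≡ true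
⊆⇒subsetB {n} {T} {S} T⊆S = cong not (IsZero⇒anyFin-false n _ entry)
  where
  entry : ∀ i → not (not (T i) ∨ S i) ≡ false
  entry i with T i in eq
  ... | false = refl
  ... | true rewrite T⊆S i eq = refl

punchIn-cases : {s : ℕ} (i : Fin (suc s)) (P : Fin (suc s) → Set) →
                P i → (∀ a → P (punchIn i a)) → ∀ c → P c
punchIn-cases i P Pi Pa c with i ≟F c
... | yes refl = Pi
... | no i≢c = subst P (punchIn-punchOut i≢c) (Pa (punchOut i≢c))

xorFin-punchIn : (n : ℕ) (f : Bits (suc n)) (i : Fin (suc n)) →
                 xorFin (suc n) f ≡ f i xor xorFin n (removeAt f i)
xorFin-punchIn n f fzero = refl
xorFin-punchIn (suc n) f (fsuc i) =
  trans (cong (f fzero xor_) (xorFin-punchIn n (λ a → f (fsuc a)) i))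
        (swap (f fzero) (f (fsuc i)) _)
  where
  open xor-∧-Solver
  swap : ∀ a b c → a xor (b xor c) ≡ b xor (a xor c)
  swap = solve 3 (λ a b c → a :+ (b :+ c) := b :+ (a :+ c)) refl

card-punchIn : (n : ℕ) (S : Bits (suc n)) (i : Fin (suc n)) →
               card (suc n) S ≡ bit (S i) + card n (removeAt S i)
card-punchIn n S fzero = refl
card-punchIn (suc n) S (fsuc i) =
  trans (cong (bit (S fzero) +_) (card-punchIn n (λ a → S (fsuc a)) i))
        (+-swapˡ (bit (S fzero)) (bit (S (fsuc i))) _)

card-insertAt : (n : ℕ) (S : Bits n) (i : Fin (suc n)) (b : Bool) →
                card (suc n) (insertAt S i b) ≡ bit b + card n S
card-insertAt n S i b =
  trans (card-punchIn n (insertAt S i b) i)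
        (cong₂ (λ c d → bit c + d) (insertAt-lookup S i b) (card-cong n (insertAt-punchIn S i b)))

insertAt-⊆ : {s : ℕ} (T' : Bits s) (i : Fin (suc s)) (b : Bool) (S : Bits (suc s)) →
             (b ≡ true → S i ≡ true) → T' ⊆ (removeAt S i) → insertAt T' i b ⊆ S
insertAt-⊆ T' i b S hi h = punchIn-cases i (λ c → insertAt T' i b c ≡ true → S c ≡ true)
  (λ e → hi (trans (sym (insertAt-lookup T' i b)) e))
  (λ a e → h a (trans (sym (insertAt-punchIn T' i b a)) e))

-- The enumeration allBits

prepend : {n : ℕ} → Bool → Bits n → Bits (suc n)
prepend b v fzero = b
prepend b v (fsuc i) = v i

allBits-complete : (n : ℕ) (v : Bits n) → Any (_≗ v) (allBits n)
allBits-complete zero v = here (λ ())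
allBits-complete (suc n) v =
  concatMap⁺ _ (Any.map (λ p → pick p (λ { fzero → refl ; (fsuc i) → refl })
                                     (λ { fzero → refl ; (fsuc i) → refl }))
                      (allBits-complete n (λ i → v (fsuc i))))
  where
  pick : {w : Bits n} {u₀ u₁ : Bits (suc n)} → w ≗ (λ i → v (fsuc i)) →
         u₀ ≗ prepend false w → u₁ ≗ prepend true w → Any (_≗ v) (u₀ ∷ u₁ ∷ [])
  pick p e₀ e₁ with v fzero in eq
  ... | false = here (λ { fzero → trans (e₀ fzero) (sym eq) ; (fsuc i) → trans (e₀ (fsuc i)) (p i) })
  ... | true = there (here (λ { fzero → trans (e₁ fzero) (sym eq) ; (fsuc i) → trans (e₁ (fsuc i)) (p i) }))

allL-true : {A : Set} (p : A → Bool) (xs : List A) → allL p xs ≡ true →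
            {P : A → Set} → Any P xs → Σ A (λ x → P x × p x ≡ true)
allL-true p (x ∷ xs) e (here Px) = x , Px , ∧-conicalˡ (p x) _ e
allL-true p (x ∷ xs) e (there a) = allL-true p xs (∧-conicalʳ (p x) _ e) a

allL-intro : {A : Set} (p : A → Bool) (xs : List A) → (∀ x → p x ≡ true) → allL p xs ≡ true
allL-intro p [] h = refl
allL-intro p (x ∷ xs) h = cong₂ _∧_ (h x) (allL-intro p xs h)

allL-false : {A : Set} (p : A → Bool) (xs : List A) → allL p xs ≡ false → Σ A (λ x → p x ≡ false)
allL-false p (x ∷ xs) e with p x in eq
... | false = x , eq
... | true = allL-false p xs e

-- Rank as the size of a largest independent set of rows

Independent : {m : ℕ} → Mat m → Bits m → Set
Independent M S = ∀ T → T ⊆ S → IsZero (rowSum M T) → IsZero T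

isNotDependency : {m : ℕ} → Mat m → Bits m → Bits m → Bool
isNotDependency {m} M S T = not (subsetB T S ∧ anyFin m T) ∨ anyFin m (rowSum M T)

isNotDependency-cong : {m : ℕ} (M : Mat m) (S : Bits m) {T T' : Bits m} → T ≗ T' →
                       isNotDependency M S T ≡ isNotDependency M S T'
isNotDependency-cong {m} M S e =
  cong₂ _∨_ (cong₂ (λ a b → not (a ∧ b)) (cong not (anyFin-cong m (λ i → cong (λ a → not (not a ∨ S i)) (e i))))
                                         (anyFin-cong m e))
            (anyFin-cong m (λ j → xorFin-cong m (λ i → cong (_∧ M i j) (e i))))

independentRows-sound : {m : ℕ} (M : Mat m) (S : Bits m) → independentRows M S ≡ true → Independent M S
independentRows-sound {m} M S e T T⊆S zero-sum
  with allL-true (isNotDependency M S) (allBits m) e (allBits-complete m T)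
... | T' , T'≗T , ok = anyFin-false⇒IsZero m T (decode (trans (sym (isNotDependency-cong M S T'≗T)) ok))
  where
  decode : isNotDependency M S T ≡ true → anyFin m T ≡ false
  decode h rewrite ⊆⇒subsetB T⊆S | IsZero⇒anyFin-false m (rowSum M T) zero-sum with anyFin m T
  ... | false = refl
  decode () | true

independentRows-complete : {m : ℕ} (M : Mat m) (S : Bits m) → Independent M S → independentRows M S ≡ true
independentRows-complete {m} M S ind = allL-intro (isNotDependency M S) (allBits m) check
  where
  check : ∀ T → isNotDependency M S T ≡ true
  check T with subsetB T S in e₁ | anyFin m T in e₂ | anyFin m (rowSum M T) in e₃
  ... | false | _ | _ = refl
  ... | true | false | _ = refl
  ... | true | true | true = refl
  ... | true | true | false =
    ⊥-elim (true≢false (trans (sym e₂)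
      (IsZero⇒anyFin-false m T (ind T (subsetB⇒⊆ e₁) (anyFin-false⇒IsZero m _ e₃)))))

independentRows-false : {m : ℕ} (M : Mat m) (S : Bits m) → independentRows M S ≡ false →
  Σ (Bits m) (λ T → T ⊆ S × Σ (Fin m) (λ t → T t ≡ true) × IsZero (rowSum M T))
independentRows-false {m} M S e with allL-false (isNotDependency M S) (allBits m) e
... | T , _ with subsetB T S in e₁ | anyFin m T in e₂ | anyFin m (rowSum M T) in e₃
...   | true | true | false =
        T , subsetB⇒⊆ e₁ , anyFin-true⇒witness m T e₂ , anyFin-false⇒IsZero m _ e₃
independentRows-false M S e | T , () | false | _ | _
independentRows-false M S e | T , () | true | false | _
independentRows-false M S e | T , () | true | true | true

maxOver : {A : Set} → (A → ℕ) → List A → ℕ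
maxOver f = foldr (λ S r → f S ⊔ r) 0

maxOver-ub : {A : Set} (f : A → ℕ) (xs : List A) {c : ℕ} → Any (λ w → f w ≡ c) xs → c ≤ maxOver f xs
maxOver-ub f (x ∷ xs) (here refl) = m≤m⊔n (f x) (maxOver f xs)
maxOver-ub f (x ∷ xs) (there a) = ≤-trans (maxOver-ub f xs a) (m≤n⊔m (f x) (maxOver f xs))

maxOver-attained : {A : Set} (f : A → ℕ) (xs : List A) →
                   (maxOver f xs ≡ 0) ⊎ Σ A (λ w → f w ≡ maxOver f xs)
maxOver-attained f [] = inj₁ refl
maxOver-attained f (x ∷ xs) with ⊔-sel (f x) (maxOver f xs)
... | inj₁ e = inj₂ (x , sym e)
... | inj₂ e with maxOver-attained f xs
...   | inj₁ z = inj₁ (trans e z)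
...   | inj₂ (w , q) = inj₂ (w , trans q (sym e))

sizeIfIndependent : {m : ℕ} → Mat m → Bits m → ℕ
sizeIfIndependent {m} M S = if independentRows M S then card m S else 0

rank-ub : {m : ℕ} (M : Mat m) (S : Bits m) → Independent M S → card m S ≤ rank M
rank-ub {m} M S ind = maxOver-ub (sizeIfIndependent M) (allBits m) (Any.map size (allBits-complete m S))
  where
  size : ∀ {w} → w ≗ S → sizeIfIndependent M w ≡ card m S
  size {w} w≗S rewrite independentRows-complete M w (λ T T⊆w → ind T (λ i e → subst (_≡ true) (w≗S i) (T⊆w i e)))
    = card-cong m w≗S

nothing : {m : ℕ} → Bits m
nothing _ = false

card-nothing : (m : ℕ) → card m nothing ≡ 0
card-nothing zero = refl
card-nothing (suc m) = card-nothing m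

nothing-independent : {m : ℕ} (M : Mat m) → Independent M nothing
nothing-independent M T T⊆∅ _ i with T i in e
... | false = refl
... | true = sym (T⊆∅ i e)

rank-attained : {m : ℕ} (M : Mat m) → Σ (Bits m) (λ S → Independent M S × card m S ≡ rank M)
rank-attained {m} M with maxOver-attained (sizeIfIndependent M) (allBits m)
... | inj₁ z = nothing , nothing-independent M , trans (card-nothing m) (sym z)
... | inj₂ (w , q) with independentRows M w in eq
...   | true = w , independentRows-sound M w eq , q
...   | false = nothing , nothing-independent M , trans (card-nothing m) q

rank-compare : {m n : ℕ} (A : Mat m) (B : Mat n) (k l : ℕ) →
  (∀ S → Independent A S → Σ (Bits n) (λ S' → Independent B S' × k + card m S ≤ l + card n S')) →
  k + rank A ≤ l + rank B
rank-compare {m} {n} A B k l h with rank-attained A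
... | S , indS , cardS with h S indS
...   | S' , indS' , le =
  subst (λ r → k + r ≤ l + rank B) cardS (≤-trans le (+-monoʳ-≤ l (rank-ub B S' indS')))

rank-≡ : {m : ℕ} (A B : Mat m) → (∀ S → Independent A S → Independent B S) →
         (∀ S → Independent B S → Independent A S) → rank A ≡ rank B
rank-≡ A B f g = ≤-antisym (rank-compare A B 0 0 (λ S i → S , f S i , ≤-refl))
                           (rank-compare B A 0 0 (λ S i → S , g S i , ≤-refl))

-- Operations that preserve or control the rank

xorFin-xor : (n : ℕ) (f g : Bits n) → xorFin n (λ i → f i xor g i) ≡ xorFin n f xor xorFin n g
xorFin-xor zero f g = refl
xorFin-xor (suc n) f g =
  trans (cong ((f fzero xor g fzero) xor_) (xorFin-xor n (λ i → f (fsuc i)) (λ i → g (fsuc i))))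
        (interchange (f fzero) (g fzero) _ _)
  where
  open xor-∧-Solver
  interchange : ∀ a b c d → (a xor b) xor (c xor d) ≡ (a xor c) xor (b xor d)
  interchange = solve 4 (λ a b c d → (a :+ b) :+ (c :+ d) := (a :+ c) :+ (b :+ d)) refl

xorFin-∧ : (n : ℕ) (f : Bits n) (c : Bool) → xorFin n (λ i → f i ∧ c) ≡ xorFin n f ∧ c
xorFin-∧ zero f c = refl
xorFin-∧ (suc n) f c =
  trans (cong ((f fzero ∧ c) xor_) (xorFin-∧ n (λ i → f (fsuc i)) c))
        (sym (∧-distribʳ-xor c (f fzero) _))

xorFin-zero : (n : ℕ) (f : Bits n) → IsZero f → xorFin n f ≡ false
xorFin-zero zero f z = refl
xorFin-zero (suc n) f z = cong₂ _xor_ (z fzero) (xorFin-zero n (λ i → f (fsuc i)) (λ i → z (fsuc i)))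

rank-≡-dependencies : {m : ℕ} (A B : Mat m) →
  (∀ T → IsZero (rowSum A T) → IsZero (rowSum B T)) →
  (∀ T → IsZero (rowSum B T) → IsZero (rowSum A T)) → rank A ≡ rank B
rank-≡-dependencies A B f g =
  rank-≡ A B (λ S ind T T⊆S z → ind T T⊆S (g T z)) (λ S ind T T⊆S z → ind T T⊆S (f T z))

rank-ext : {m : ℕ} (A B : Mat m) → (∀ i j → A i j ≡ B i j) → rank A ≡ rank B
rank-ext {m} A B e = rank-≡-dependencies A B
  (λ T z j → trans (xorFin-cong m (λ k → cong (T k ∧_) (sym (e k j)))) (z j))
  (λ T z j → trans (xorFin-cong m (λ k → cong (T k ∧_) (e k j))) (z j))

addColumn : {m : ℕ} → Mat m → Fin m → Bits m → Mat m
addColumn M j u a b = M a b xor (M a j ∧ u b)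

rowSum-addColumn : {m : ℕ} (M : Mat m) (j : Fin m) (u T : Bits m) (b : Fin m) →
                   rowSum (addColumn M j u) T b ≡ rowSum M T b xor (rowSum M T j ∧ u b)
rowSum-addColumn {m} M j u T b = begin
  xorFin m (λ i → T i ∧ (M i b xor (M i j ∧ u b)))
    ≡⟨ xorFin-cong m (λ i → trans (∧-distribˡ-xor (T i) _ _) (cong ((T i ∧ M i b) xor_) (sym (∧-assoc (T i) _ _)))) ⟩
  xorFin m (λ i → (T i ∧ M i b) xor ((T i ∧ M i j) ∧ u b))
    ≡⟨ xorFin-xor m _ _ ⟩
  rowSum M T b xor xorFin m (λ i → (T i ∧ M i j) ∧ u b)
    ≡⟨ cong (rowSum M T b xor_) (xorFin-∧ m (λ i → T i ∧ M i j) (u b)) ⟩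
  rowSum M T b xor (rowSum M T j ∧ u b) ∎
  where open ≡-Reasoning

rank-addColumn : {m : ℕ} (M : Mat m) (j : Fin m) (u : Bits m) → u j ≡ false →
                 rank (addColumn M j u) ≡ rank M
rank-addColumn {m} M j u uj = rank-≡-dependencies _ _ to from
  where
  to : ∀ T → IsZero (rowSum (addColumn M j u) T) → IsZero (rowSum M T)
  to T z b = begin
    rowSum M T b                              ≡⟨ sym (xor-identityʳ _) ⟩
    rowSum M T b xor (false ∧ u b)            ≡⟨ cong (λ c → rowSum M T b xor (c ∧ u b)) (sym column-j) ⟩
    rowSum M T b xor (rowSum M T j ∧ u b)     ≡⟨ sym (rowSum-addColumn M j u T b) ⟩
    rowSum (addColumn M j u) T b              ≡⟨ z b ⟩
    false                                     ∎
    where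
    open ≡-Reasoning
    -- column j itself is unchanged, since u j = false
    column-j : rowSum M T j ≡ false
    column-j = begin
      rowSum M T j                            ≡⟨ sym (xor-identityʳ _) ⟩
      rowSum M T j xor false                  ≡⟨ cong (rowSum M T j xor_) (sym (trans (cong (rowSum M T j ∧_) uj) (∧-zeroʳ _))) ⟩
      rowSum M T j xor (rowSum M T j ∧ u j)   ≡⟨ sym (rowSum-addColumn M j u T j) ⟩
      rowSum (addColumn M j u) T j            ≡⟨ z j ⟩
      false                                   ∎
  from : ∀ T → IsZero (rowSum M T) → IsZero (rowSum (addColumn M j u) T)
  from T z b rewrite rowSum-addColumn M j u T b | z b | z j = refl

minor : {s : ℕ} → Mat (suc s) → Fin (suc s) → Fin (suc s) → Mat s
minor M i j a b = M (punchIn i a) (punchIn j b)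

otherRowsSum : {s : ℕ} → Mat (suc s) → Fin (suc s) → Bits s → Fin (suc s) → Bool
otherRowsSum {s} M i T' c = xorFin s (λ a → T' a ∧ M (punchIn i a) c)

rowSum-insertAt : {s : ℕ} (M : Mat (suc s)) (i : Fin (suc s)) (T' : Bits s) (b : Bool) (c : Fin (suc s)) →
                  rowSum M (insertAt T' i b) c ≡ (b ∧ M i c) xor otherRowsSum M i T' c
rowSum-insertAt {s} M i T' b c =
  trans (xorFin-punchIn s (λ k → insertAt T' i b k ∧ M k c) i)
        (cong₂ _xor_ (cong (_∧ M i c) (insertAt-lookup T' i b))
                     (xorFin-cong s (λ a → cong (_∧ M (punchIn i a) c) (insertAt-punchIn T' i b a))))

module DeleteRow {s : ℕ} (M : Mat (suc s)) (i j : Fin (suc s))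
                 (row-i : ∀ b → M i (punchIn j b) ≡ false) where

  D : Mat s
  D = minor M i j

  defect : Bits s → Bool
  defect T' = otherRowsSum M i T' j

  lift : (T' : Bits s) (γ : Bool) → (γ ∧ M i j) xor defect T' ≡ false →
         IsZero (rowSum D T') → IsZero (rowSum M (insertAt T' i γ))
  lift T' γ column z = punchIn-cases j (λ c → rowSum M (insertAt T' i γ) c ≡ false)
    (trans (rowSum-insertAt M i T' γ j) column)
    (λ b → trans (rowSum-insertAt M i T' γ (punchIn j b))
                 (trans (cong (λ x → (γ ∧ x) xor rowSum D T' b) (row-i b))
                        (trans (cong (_xor rowSum D T' b) (∧-zeroʳ γ)) (z b))))

  restrict : (T : Bits (suc s)) → IsZero (rowSum M T) → IsZero (rowSum D (removeAt T i))
  restrict T z b = begin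
    rest                                 ≡⟨ cong (_xor rest) (sym (∧-zeroʳ (T i))) ⟩
    (T i ∧ false) xor rest               ≡⟨ cong (λ x → (T i ∧ x) xor rest) (sym (row-i b)) ⟩
    (T i ∧ M i (punchIn j b)) xor rest   ≡⟨ sym (xorFin-punchIn s (λ k → T k ∧ M k (punchIn j b)) i) ⟩
    rowSum M T (punchIn j b)             ≡⟨ z (punchIn j b) ⟩
    false                                ∎
    where
    open ≡-Reasoning
    rest : Bool
    rest = otherRowsSum M i (removeAt T i) (punchIn j b)

  restrict-column : (T : Bits (suc s)) → IsZero (rowSum M T) →
                    (T i ∧ M i j) xor defect (removeAt T i) ≡ false
  restrict-column T z = trans (sym (xorFin-punchIn s (λ k → T k ∧ M k j) i)) (z j)

  lifted-vanishes : (S : Bits (suc s)) → Independent M S →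
    (T' : Bits s) (γ : Bool) → (γ ∧ M i j) xor defect T' ≡ false →
    T' ⊆ (removeAt S i) → (γ ≡ true → S i ≡ true) → IsZero (rowSum D T') → IsZero T'
  lifted-vanishes S indS T' γ column T'⊆S γ⊆S z a =
    trans (sym (insertAt-punchIn T' i γ a))
          (indS (insertAt T' i γ) (insertAt-⊆ T' i γ S γ⊆S T'⊆S) (lift T' γ column z) (punchIn i a))

  undefective-vanishes : (S : Bits (suc s)) → Independent M S → (T' : Bits s) →
    defect T' ≡ false → T' ⊆ (removeAt S i) → IsZero (rowSum D T') → IsZero T'
  undefective-vanishes S indS T' d T'⊆S' = lifted-vanishes S indS T' false d T'⊆S' (λ ())

combination-xor : (n : ℕ) (T U f : Bits n) →
  xorFin n (λ a → (T a xor U a) ∧ f a) ≡ xorFin n (λ a → T a ∧ f a) xor xorFin n (λ a → U a ∧ f a)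
combination-xor n T U f = trans (xorFin-cong n (λ a → ∧-distribʳ-xor (f a) (T a) (U a))) (xorFin-xor n _ _)

without : {n : ℕ} → Bits n → Fin n → Bits n
without {suc n} S t = insertAt (removeAt S t) t false

without-at : {n : ℕ} (S : Bits n) (t : Fin n) → without S t t ≡ false
without-at {suc n} S t = insertAt-lookup _ t false

without-⊆ : {n : ℕ} (S : Bits n) (t : Fin n) → without S t ⊆ S
without-⊆ {suc n} S t = insertAt-⊆ _ t false S (λ ()) (λ a e → e)

card-without : {n : ℕ} (S : Bits n) (t : Fin n) → S t ≡ true → card n S ≡ suc (card n (without S t))
card-without {suc n} S t St =
  trans (card-punchIn n S t) (trans (cong (λ b → bit b + card n S') St) (cong suc (sym (card-insertAt n S' t false))))
  where
  S' : Bits n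
  S' = removeAt S t

module Pivot {s : ℕ} (M : Mat (suc s)) (i j : Fin (suc s))
             (pivot : M i j ≡ true) (row-i : ∀ b → M i (punchIn j b) ≡ false) where
  open DeleteRow M i j row-i

  cancels : (T' : Bits s) → (defect T' ∧ M i j) xor defect T' ≡ false
  cancels T' rewrite pivot = trans (cong (_xor defect T') (∧-identityʳ (defect T'))) (xor-same (defect T'))

  extend : (S' : Bits s) → Independent D S' → Independent M (insertAt S' i true)
  extend S' indS' T T⊆S z = punchIn-cases i (λ c → T c ≡ false) T-i T'-zero
    where
    T' : Bits s
    T' = removeAt T i
    T'-zero : IsZero T'
    T'-zero = indS' T' (λ a e → trans (sym (insertAt-punchIn S' i true a)) (T⊆S (punchIn i a) e)) (restrict T z)
    T-i : T i ≡ false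
    T-i = begin
      T i                              ≡⟨ sym (xor-identityʳ _) ⟩
      T i xor false                    ≡⟨ cong₂ _xor_ (sym (∧-identityʳ (T i))) (sym (xorFin-zero s _ (λ a → cong (_∧ M (punchIn i a) j) (T'-zero a)))) ⟩
      (T i ∧ true) xor defect T'       ≡⟨ cong (λ x → (T i ∧ x) xor defect T') (sym pivot) ⟩
      (T i ∧ M i j) xor defect T'      ≡⟨ restrict-column T z ⟩
      false                            ∎
      where open ≡-Reasoning

  -- If S is independent in M, and T' is a nonzero dependency of D among the
  -- other rows of S, containing t, then removing t from them leaves an
  -- independent set of D: dependencies there are determined by their
  -- defect, and the defect of T' is nonzero.
  drop-one : (S : Bits (suc s)) → Independent M S → (T' : Bits s) → T' ⊆ removeAt S i →
             (t : Fin s) → T' t ≡ true → IsZero (rowSum D T') → Independent D (without (removeAt S i) t)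
  drop-one S indS T' T'⊆S' t T't zT' U' U'⊆S'' zU' with defect U' in d
  ... | false = undefective-vanishes S indS U' d (λ a e → without-⊆ (removeAt S i) t a (U'⊆S'' a e)) zU'
  ... | true = ⊥-elim (true≢false (trans (sym W't) (undefective-vanishes S indS W' defect-W' W'⊆S' zW' t)))
    where
    S' : Bits s
    S' = removeAt S i
    defect-T' : defect T' ≡ true
    defect-T' with defect T' in d'
    ... | true = refl
    ... | false = ⊥-elim (true≢false (trans (sym T't) (undefective-vanishes S indS T' d' T'⊆S' zT' t)))
    -- the sum of the two dependencies has zero defect but contains t
    W' : Bits s
    W' a = T' a xor U' a
    U't : U' t ≡ false
    U't with U' t in e
    ... | false = refl
    ... | true = trans (sym (U'⊆S'' t e)) (without-at S' t)
    W't : W' t ≡ true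
    W't = cong₂ _xor_ T't U't
    defect-W' : defect W' ≡ false
    defect-W' = trans (combination-xor s T' U' _) (cong₂ _xor_ defect-T' d)
    zW' : IsZero (rowSum D W')
    zW' b = trans (combination-xor s T' U' _) (cong₂ _xor_ (zT' b) (zU' b))
    W'⊆S' : W' ⊆ S'
    W'⊆S' a e with T' a in e₁ | U' a in e₂
    ... | true | _ = T'⊆S' a e₁
    ... | false | true = without-⊆ S' t a (U'⊆S'' a e₂)

  shrink : (S : Bits (suc s)) → Independent M S →
           Σ (Bits s) (λ S'' → Independent D S'' × 0 + card (suc s) S ≤ 1 + card s S'')
  shrink S indS with S i in Si | card-punchIn s S i
  ... | true | cardS = removeAt S i , independent , ≤-reflexive cardS
    where
    independent : Independent D (removeAt S i)
    independent T' T'⊆S' z = lifted-vanishes S indS T' (defect T') (cancels T') T'⊆S' (λ _ → Si) z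
  ... | false | cardS with independentRows D (removeAt S i) in eq
  ...   | true = removeAt S i , independentRows-sound D _ eq , ≤-trans (≤-reflexive cardS) (n≤1+n _)
  ...   | false with independentRows-false D (removeAt S i) eq
  ...     | T' , T'⊆S' , (t , T't) , zT' =
    without (removeAt S i) t , drop-one S indS T' T'⊆S' t T't zT' ,
    ≤-reflexive (trans cardS (card-without (removeAt S i) t (T'⊆S' t T't)))

rank-pivot : {s : ℕ} (M : Mat (suc s)) (i j : Fin (suc s)) → M i j ≡ true →
             (∀ b → M i (punchIn j b) ≡ false) → rank M ≡ suc (rank (minor M i j))
rank-pivot {s} M i j pivot row-i = ≤-antisym
  (rank-compare M (minor M i j) 0 1 shrink)
  (rank-compare (minor M i j) M 1 0
     (λ S' ind → insertAt S' i true , extend S' ind , ≤-reflexive (sym (card-insertAt s S' i true))))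
  where open Pivot M i j pivot row-i

module ZeroLine {s : ℕ} (M : Mat (suc s)) (i j : Fin (suc s))
                (row-i : ∀ c → M i c ≡ false) (column-j : ∀ a → M (punchIn i a) j ≡ false) where
  open DeleteRow M i j (λ b → row-i (punchIn j b))

  cancels : (T' : Bits s) (γ : Bool) → (γ ∧ M i j) xor defect T' ≡ false
  cancels T' γ = cong₂ _xor_ (trans (cong (γ ∧_) (row-i j)) (∧-zeroʳ γ))
                             (xorFin-zero s _ (λ a → trans (cong (T' a ∧_) (column-j a)) (∧-zeroʳ _)))

  outside : (S : Bits (suc s)) → Independent M S → S i ≡ false
  outside S indS with S i in Si
  ... | false = refl
  ... | true = trans (sym (insertAt-lookup nothing i true))
                 (indS _ (insertAt-⊆ nothing i true S (λ _ → Si) (λ a ()))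
                       (lift nothing true (cancels nothing true) (λ b → xorFin-zero s _ (λ _ → refl))) i)

  shrink : (S : Bits (suc s)) → Independent M S →
           Σ (Bits s) (λ S' → Independent D S' × 0 + card (suc s) S ≤ 0 + card s S')
  shrink S indS = (removeAt S i)
                , (λ T' T'⊆S' z → lifted-vanishes S indS T' false (cancels T' false) T'⊆S' (λ ()) z)
                , ≤-reflexive (trans (card-punchIn s S i) (cong (λ b → bit b + card s (removeAt S i)) (outside S indS)))

  extend : (S' : Bits s) → Independent D S' → Independent M (insertAt S' i false)
  extend S' indS' T T⊆S z = punchIn-cases i (λ c → T c ≡ false) T-i
    (indS' _ (λ a e → trans (sym (insertAt-punchIn S' i false a)) (T⊆S (punchIn i a) e)) (restrict T z))
    where
    T-i : T i ≡ false
    T-i with T i in e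
    ... | false = refl
    ... | true = trans (sym (T⊆S i e)) (insertAt-lookup S' i false)

rank-zeroLine : {s : ℕ} (M : Mat (suc s)) (i j : Fin (suc s)) → (∀ c → M i c ≡ false) →
                (∀ a → M (punchIn i a) j ≡ false) → rank M ≡ rank (minor M i j)
rank-zeroLine {s} M i j row-i column-j = ≤-antisym
  (rank-compare M (minor M i j) 0 0 shrink)
  (rank-compare (minor M i j) M 0 0
     (λ S' ind → insertAt S' i false , extend S' ind , ≤-reflexive (sym (card-insertAt s S' i false))))
  where open ZeroLine M i j row-i column-j

-- Matrices indexed by natural numbers

-- A matrix of size s is read off from the entries of an ℕ-indexed matrix
-- below s; this lets the size vary while the entries stay fixed.
ℕMat : Set
ℕMat = ℕ → ℕ → Bool

truncate : (s : ℕ) → ℕMat → Mat s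
truncate s A i j = A (toℕ i) (toℕ j)

rk : ℕ → ℕMat → ℕ
rk s A = rank (truncate s A)

rk-ext : (s : ℕ) (A B : ℕMat) → (∀ a b → a < s → b < s → A a b ≡ B a b) → rk s A ≡ rk s B
rk-ext s A B e = rank-ext (truncate s A) (truncate s B) (λ i j → e (toℕ i) (toℕ j) (toℕ<n i) (toℕ<n j))

≡ᵇ-refl : ∀ n → (n ≡ᵇ n) ≡ true
≡ᵇ-refl n = dec-true (n ≟ n) refl

≡ᵇ-≢ : ∀ {a b} → a ≢ b → (a ≡ᵇ b) ≡ false
≡ᵇ-≢ {a} {b} = dec-false (a ≟ b)

≡ᵇ-true : ∀ a b → (a ≡ᵇ b) ≡ true → a ≡ b
≡ᵇ-true a b e = ≡ᵇ⇒≡ a b (subst T (sym e) tt)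

-- punchIn on natural numbers: skip p enumerates ℕ without p.
skip : ℕ → ℕ → ℕ
skip zero a = suc a
skip (suc p) zero = zero
skip (suc p) (suc a) = suc (skip p a)

toℕ-punchIn : {s : ℕ} (i : Fin (suc s)) (a : Fin s) → toℕ (punchIn i a) ≡ skip (toℕ i) (toℕ a)
toℕ-punchIn fzero a = refl
toℕ-punchIn (fsuc i) fzero = refl
toℕ-punchIn (fsuc i) (fsuc a) = cong suc (toℕ-punchIn i a)

skip-< : ∀ {p a} → a < p → skip p a ≡ a
skip-< {suc p} {zero} _ = refl
skip-< {suc p} {suc a} (s≤s a<p) = cong suc (skip-< a<p)

skip-≥ : ∀ {p a} → p ≤ a → skip p a ≡ suc a
skip-≥ {zero} _ = refl
skip-≥ {suc p} {suc a} (s≤s p≤a) = cong suc (skip-≥ p≤a)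

skip-≢ : ∀ p a → skip p a ≢ p
skip-≢ zero a ()
skip-≢ (suc p) (suc a) e = skip-≢ p a (suc-injective e)

schur : ℕMat → ℕ → ℕ → ℕMat
schur A p q a b = A a b xor (A a q ∧ A p b)

-- Gaussian elimination: at a pivot A p q = 1 the rank drops by one, leaving
-- the Schur complement with row p and column q deleted.  (Clear row p by
-- column operations, then pivot.)
rk-eliminate : (s p q : ℕ) (A : ℕMat) → p < suc s → q < suc s → A p q ≡ true →
               rk (suc s) A ≡ suc (rk s (λ a b → schur A p q (skip p a) (skip q b)))
rk-eliminate s p q A p< q< pivot = begin
  rank M                       ≡⟨ sym (rank-addColumn M Q u u-Q) ⟩
  rank M'                      ≡⟨ rank-pivot M' P Q pivot' row-P ⟩
  suc (rank (minor M' P Q))    ≡⟨ cong suc (rank-ext _ _ minor-entries) ⟩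
  suc (rk s (λ a b → schur A p q (skip p a) (skip q b))) ∎
  where
  open ≡-Reasoning
  M : Mat (suc s)
  M = truncate (suc s) A
  P Q : Fin (suc s)
  P = fromℕ< p<
  Q = fromℕ< q<
  -- the multiples of column q that clear row p off the pivot
  u : Bits (suc s)
  u c = A p (toℕ c) ∧ not (toℕ c ≡ᵇ q)
  M' : Mat (suc s)
  M' = addColumn M Q u
  u-Q : u Q ≡ false
  u-Q rewrite toℕ-fromℕ< q< | ≡ᵇ-refl q = ∧-zeroʳ _
  pivot' : M' P Q ≡ true
  pivot' rewrite u-Q | toℕ-fromℕ< p< | toℕ-fromℕ< q< | pivot = refl
  row-index : (a : Fin s) → toℕ (punchIn P a) ≡ skip p (toℕ a)
  row-index a = trans (toℕ-punchIn P a) (cong (λ x → skip x (toℕ a)) (toℕ-fromℕ< p<))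
  column-index : (b : Fin s) → toℕ (punchIn Q b) ≡ skip q (toℕ b)
  column-index b = trans (toℕ-punchIn Q b) (cong (λ x → skip x (toℕ b)) (toℕ-fromℕ< q<))
  off-pivot : (b : Fin s) → (toℕ (punchIn Q b) ≡ᵇ q) ≡ false
  off-pivot b = ≡ᵇ-≢ (λ e → skip-≢ q (toℕ b) (trans (sym (column-index b)) e))
  row-P : ∀ b → M' P (punchIn Q b) ≡ false
  row-P b rewrite off-pivot b | toℕ-fromℕ< p< | toℕ-fromℕ< q< | pivot | ∧-identityʳ (A p (toℕ (punchIn Q b))) =
    xor-same (A p (toℕ (punchIn Q b)))
  minor-entries : ∀ a b → minor M' P Q a b ≡ schur A p q (skip p (toℕ a)) (skip q (toℕ b))
  minor-entries a b rewrite off-pivot b | toℕ-fromℕ< q< | ∧-identityʳ (A p (toℕ (punchIn Q b)))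
    = cong₂ (λ a' b' → A a' b' xor (A a' q ∧ A p b')) (row-index a) (column-index b)

rk-zeroLast : (s : ℕ) (A : ℕMat) → (∀ b → b < suc s → A s b ≡ false) → (∀ a → a < s → A a s ≡ false) →
              rk (suc s) A ≡ rk s A
rk-zeroLast s A row column = begin
  rank M                  ≡⟨ rank-zeroLine M L L (λ c → trans (cong (λ x → A x (toℕ c)) (toℕ-fromℕ s)) (row (toℕ c) (toℕ<n c)))
                                                 (λ a → trans (cong₂ A (last a) (toℕ-fromℕ s)) (column (toℕ a) (toℕ<n a))) ⟩
  rank (minor M L L)      ≡⟨ rank-ext _ _ (λ a b → cong₂ A (last a) (last b)) ⟩
  rk s A                  ∎
  where
  open ≡-Reasoning
  M : Mat (suc s)
  M = truncate (suc s) A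
  L : Fin (suc s)
  L = fromℕ s
  last : (a : Fin s) → toℕ (punchIn L a) ≡ toℕ a
  last a = trans (toℕ-punchIn L a) (trans (cong (λ x → skip x (toℕ a)) (toℕ-fromℕ s)) (skip-< (toℕ<n a)))

-- Arrow and tridiagonal matrices

Seq : Set
Seq = ℕ → Bool

tridiag : Seq → Seq → ℕMat
tridiag x y a b = if a ≡ᵇ b then x a else if b ≡ᵇ suc a then y a else if a ≡ᵇ suc b then y b else false

arrow : Seq → Seq → Seq → ℕMat
arrow x y z zero zero = x 0
arrow x y z zero (suc b) = z b
arrow x y z (suc a) zero = z a
arrow x y z (suc a) (suc b) = tridiag (λ i → x (suc i)) y a b

tog : Seq → ℕ → Bool → Seq
tog x k c i = if i ≡ᵇ k then x i xor c else x i

tog-cong : (k : ℕ) {x x' : Seq} {c c' : Bool} → x ≗ x' → c ≡ c' → tog x k c ≗ tog x' k c'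
tog-cong k ex ec i = cong₂ (λ u d → if i ≡ᵇ k then u xor d else u) (ex i) ec

≡ᵇ-sym : ∀ a b → (a ≡ᵇ b) ≡ (b ≡ᵇ a)
≡ᵇ-sym zero zero = refl
≡ᵇ-sym zero (suc b) = refl
≡ᵇ-sym (suc a) zero = refl
≡ᵇ-sym (suc a) (suc b) = ≡ᵇ-sym a b

tridiag-local : (s : ℕ) {x x' y y' : Seq} → (∀ i → i < s → x i ≡ x' i) → (∀ i → suc i < s → y i ≡ y' i) →
                ∀ a b → a < s → b < s → tridiag x y a b ≡ tridiag x' y' a b
tridiag-local s hx hy a b a< b< with a ≡ᵇ b | b ≡ᵇ suc a in e₁ | a ≡ᵇ suc b in e₂
... | true | _ | _ = hx a a<
... | false | true | _ = hy a (subst (_< s) (≡ᵇ-true b (suc a) e₁) b<)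
... | false | false | true = hy b (subst (_< s) (≡ᵇ-true a (suc b) e₂) a<)
... | false | false | false = refl

arrow-local : (s : ℕ) {x x' y y' z z' : Seq} → (∀ i → i < s → x i ≡ x' i) →
              (∀ i → suc (suc i) < s → y i ≡ y' i) → (∀ i → suc i < s → z i ≡ z' i) →
              ∀ a b → a < s → b < s → arrow x y z a b ≡ arrow x' y' z' a b
arrow-local s hx hy hz zero zero a< b< = hx 0 a<
arrow-local s hx hy hz zero (suc b) a< b< = hz b b<
arrow-local s hx hy hz (suc a) zero a< b< = hz a a<
arrow-local (suc s) hx hy hz (suc a) (suc b) (s≤s a<) (s≤s b<) =
  tridiag-local s (λ i i< → hx (suc i) (s≤s i<)) (λ i i< → hy i (s≤s i<)) a b a< b<

rk-arrow-cong : (s : ℕ) {x x' y y' z z' : Seq} → x ≗ x' → y ≗ y' → z ≗ z' →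
                rk s (arrow x y z) ≡ rk s (arrow x' y' z')
rk-arrow-cong s ex ey ez = rk-ext s _ _ (arrow-local s (λ i _ → ex i) (λ i _ → ey i) (λ i _ → ez i))

rk-tridiag-cong : (s : ℕ) {x x' y y' : Seq} → x ≗ x' → y ≗ y' → rk s (tridiag x y) ≡ rk s (tridiag x' y')
rk-tridiag-cong s ex ey = rk-ext s _ _ (tridiag-local s (λ i _ → ex i) (λ i _ → ey i))

tridiag-sym : (x y : Seq) (a b : ℕ) → tridiag x y a b ≡ tridiag x y b a
tridiag-sym x y a b with a ≡ᵇ b in e
... | true with refl ← ≡ᵇ-true a b e rewrite ≡ᵇ-refl a = refl
... | false rewrite ≡ᵇ-sym b a | e with b ≡ᵇ suc a in e₁ | a ≡ᵇ suc b in e₂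
...   | true | true = ⊥-elim (<-irrefl a≡2+a (m<n⇒m<1+n (n<1+n a)))
  where
  a≡2+a : a ≡ suc (suc a)
  a≡2+a = trans (≡ᵇ-true a (suc b) e₂) (cong suc (≡ᵇ-true b (suc a) e₁))
...   | true | false = refl
...   | false | true = refl
...   | false | false = refl

arrow-sym : (x y z : Seq) (a b : ℕ) → arrow x y z a b ≡ arrow x y z b a
arrow-sym x y z zero zero = refl
arrow-sym x y z zero (suc b) = refl
arrow-sym x y z (suc a) zero = refl
arrow-sym x y z (suc a) (suc b) = tridiag-sym (λ i → x (suc i)) y a b

tridiag-diag : (x y : Seq) (a : ℕ) → tridiag x y a a ≡ x a
tridiag-diag x y a rewrite ≡ᵇ-refl a = refl

tridiag-tog : (x y : Seq) (k : ℕ) (c : Bool) (a b : ℕ) →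
  tridiag (tog x k c) y a b ≡ tridiag x y a b xor ((if a ≡ᵇ k then c else false) ∧ (if b ≡ᵇ k then c else false))
tridiag-tog x y k c a b with a ≡ᵇ b in e
... | true with refl ← ≡ᵇ-true a b e with a ≡ᵇ k
...   | true = cong (x a xor_) (sym (∧-idem c))
...   | false = sym (xor-identityʳ (x a))
tridiag-tog x y k c a b | false with a ≡ᵇ k in e₁ | b ≡ᵇ k in e₂
... | true | true = ⊥-elim (true≢false (trans (sym (≡ᵇ-refl a)) (subst (λ t → (a ≡ᵇ t) ≡ false) (trans (≡ᵇ-true b k e₂) (sym (≡ᵇ-true a k e₁))) e)))
... | true | false = sym (trans (cong (off xor_) (∧-zeroʳ c)) (xor-identityʳ off))
  where
  off : Bool
  off = if b ≡ᵇ suc a then y a else if a ≡ᵇ suc b then y b else false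
... | false | _ = sym (xor-identityʳ _)

tridiag-below : (x y : Seq) (k b : ℕ) → b < suc k → tridiag x y (suc k) b ≡ (if b ≡ᵇ k then y k else false)
tridiag-below x y k b b< rewrite ≡ᵇ-≢ (λ e → <-irrefl (sym e) b<) | ≡ᵇ-≢ (λ e → <-irrefl e (m<n⇒m<1+n b<))
                               | ≡ᵇ-sym k b with b ≡ᵇ k in e
... | true = cong y (≡ᵇ-true b k e)
... | false = refl

xor-if : (c : Bool) (u v : Bool) → u xor (if c then v else false) ≡ (if c then u xor v else u)
xor-if true u v = refl
xor-if false u v = xor-identityʳ u

-- The last row of an arrow matrix of size suc (suc (suc m)), off the
-- diagonal: p in column 0, q in column suc m, zero elsewhere.
border : ℕ → Bool → Bool → ℕ → Bool
border m p q zero = p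
border m p q (suc b) = if b ≡ᵇ m then q else false

border-below : (m : ℕ) (p q : Bool) (a : ℕ) → a < suc m → border m p q a ≡ p ∧ (a ≡ᵇ 0)
border-below m p q zero _ = sym (∧-identityʳ p)
border-below m p q (suc a) (s≤s a<m) = trans (cong (λ c → if c then q else false) (≡ᵇ-≢ (<⇒≢ a<m))) (sym (∧-zeroʳ p))

module LastLine (m : ℕ) (x y z : Seq) where
  n : ℕ
  n = suc (suc m)
  A : ℕMat
  A = arrow x y z
  p q : Bool
  p = z (suc m)
  q = y m

  row : ∀ b → b < n → A n b ≡ border m p q b
  row zero _ = refl
  row (suc b) (s≤s b<) = tridiag-below (λ i → x (suc i)) y m b b<

  column : ∀ a → a < n → A a n ≡ border m p q a
  column a a< = trans (arrow-sym x y z a n) (row a a<)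

  corner : A n n ≡ x n
  corner = tridiag-diag (λ i → x (suc i)) y (suc m)

  rank-one : ∀ a b → arrow x y z a b xor (border m p q a ∧ border m p q b)
                     ≡ arrow (tog (tog x 0 p) (suc m) q) y (tog z m (p ∧ q)) a b
  rank-one zero zero = cong (x 0 xor_) (∧-idem p)
  rank-one zero (suc b) with b ≡ᵇ m
  ... | true = refl
  ... | false = trans (cong (z b xor_) (∧-zeroʳ p)) (xor-identityʳ (z b))
  rank-one (suc a) zero with a ≡ᵇ m
  ... | true = cong (z a xor_) (∧-comm q p)
  ... | false = xor-identityʳ (z a)
  rank-one (suc a) (suc b) = sym (tridiag-tog (λ i → x (suc i)) y m q a b)

  rk-cornerPivot : x n ≡ true →
    rk (suc n) A ≡ suc (rk n (arrow (tog (tog x 0 p) (suc m) q) y (tog z m (p ∧ q))))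
  rk-cornerPivot xn =
    trans (rk-eliminate n n n A (n<1+n n) (n<1+n n) (trans corner xn)) (cong suc (rk-ext n _ _ entries))
    where
    entries : ∀ a b → a < n → b < n → schur A n n (skip n a) (skip n b) ≡
              arrow (tog (tog x 0 p) (suc m) q) y (tog z m (p ∧ q)) a b
    entries a b a< b< rewrite skip-< a< | skip-< b< | column a a< | row b b< = rank-one a b

  rk-emptyLast : x n ≡ false → p ≡ false → q ≡ false → rk (suc n) A ≡ rk n A
  rk-emptyLast xn pf qf = rk-zeroLast n A row-n (λ a a< → trans (column a a<) (border-zero a))
    where
    border-zero : ∀ a → border m p q a ≡ false
    border-zero zero = pf
    border-zero (suc a) rewrite qf = if-eta (a ≡ᵇ m)
    row-n : ∀ b → b < suc n → A n b ≡ false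
    row-n b b< with m<1+n⇒m<n∨m≡n b<
    ... | inj₁ b<n = trans (row b b<n) (border-zero b)
    ... | inj₂ refl = trans corner xn

  border-last : border m p q (suc m) ≡ q
  border-last rewrite ≡ᵇ-refl m = refl

  row-skip : x n ≡ false → ∀ b → b < n → A n (skip (suc m) b) ≡ p ∧ (b ≡ᵇ 0)
  row-skip xn b b< with m<1+n⇒m<n∨m≡n b<
  ... | inj₁ b<sm rewrite skip-< b<sm = trans (row b (m<n⇒m<1+n b<sm)) (border-below m p q b b<sm)
  ... | inj₂ refl rewrite skip-≥ (≤-refl {m}) = trans corner (trans xn (sym (∧-zeroʳ p)))

  -- x n = 0, q = 1: eliminating at (n, suc m), then at (suc m, suc m),
  -- leaves the following matrix of size suc m (c stands for p).
  reduced : Bool → ℕMat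
  reduced c a b = (A a b xor (A a (suc m) ∧ (c ∧ (b ≡ᵇ 0))))
                  xor ((c ∧ (a ≡ᵇ 0)) ∧ (A (suc m) b xor (A (suc m) (suc m) ∧ (c ∧ (b ≡ᵇ 0)))))

  rk-subPivot : x n ≡ false → q ≡ true → rk (suc n) A ≡ suc (suc (rk (suc m) (reduced p)))
  rk-subPivot xn qt = begin
    rk (suc n) A
      ≡⟨ rk-eliminate n n (suc m) A (n<1+n n) (m<n⇒m<1+n (n<1+n (suc m))) (trans (row (suc m) (n<1+n _)) (trans border-last qt)) ⟩
    suc (rk n (λ a b → schur A n (suc m) (skip n a) (skip (suc m) b)))
      ≡⟨ cong suc (rk-ext n _ B step₁) ⟩
    suc (rk n B)
      ≡⟨ cong suc (rk-eliminate (suc m) (suc m) (suc m) B (n<1+n _) (n<1+n _) pivot₂) ⟩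
    suc (suc (rk (suc m) (λ a b → schur B (suc m) (suc m) (skip (suc m) a) (skip (suc m) b))))
      ≡⟨ cong (λ r → suc (suc r)) (rk-ext (suc m) _ _ step₂) ⟩
    suc (suc (rk (suc m) (reduced p))) ∎
    where
    open ≡-Reasoning
    B : ℕMat
    B a b = A a (skip (suc m) b) xor (A a (suc m) ∧ (p ∧ (b ≡ᵇ 0)))
    step₁ : ∀ a b → a < n → b < n → schur A n (suc m) (skip n a) (skip (suc m) b) ≡ B a b
    step₁ a b a< b< rewrite skip-< a< = cong (λ c → A a (skip (suc m) b) xor (A a (suc m) ∧ c)) (row-skip xn b b<)
    skip-last : skip m m ≡ suc m
    skip-last = skip-≥ (≤-refl {m})
    B-last : ∀ a → a < suc m → B a (suc m) ≡ p ∧ (a ≡ᵇ 0)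
    B-last a a< rewrite skip-last | ∧-zeroʳ p | ∧-zeroʳ (A a (suc m)) | xor-identityʳ (A a n) =
      trans (column a (m<n⇒m<1+n a<)) (border-below m p q a a<)
    pivot₂ : B (suc m) (suc m) ≡ true
    pivot₂ rewrite skip-last | ∧-zeroʳ p | ∧-zeroʳ (A (suc m) (suc m)) | xor-identityʳ (A (suc m) n) =
      trans (column (suc m) (n<1+n _)) (trans border-last qt)
    B-left : ∀ a b → b < suc m → B a b ≡ A a b xor (A a (suc m) ∧ (p ∧ (b ≡ᵇ 0)))
    B-left a b b< = cong (λ c → A a c xor (A a (suc m) ∧ (p ∧ (b ≡ᵇ 0)))) (skip-< b<)
    step₂ : ∀ a b → a < suc m → b < suc m → schur B (suc m) (suc m) (skip (suc m) a) (skip (suc m) b) ≡ reduced p a b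
    step₂ a b a< b< rewrite skip-< a< | skip-< b< =
      trans (cong₂ (λ u v → u xor (v ∧ B (suc m) b)) (B-left a b b<) (B-last a a<))
            (cong (λ w → (A a b xor (A a (suc m) ∧ (p ∧ (b ≡ᵇ 0)))) xor ((p ∧ (a ≡ᵇ 0)) ∧ w)) (B-left (suc m) b b<))

  rk-subPivotOnly : x n ≡ false → q ≡ true → p ≡ false → rk (suc n) A ≡ suc (suc (rk (suc m) A))
  rk-subPivotOnly xn qt pf = trans (rk-subPivot xn qt) (cong (λ r → suc (suc r)) (rk-ext (suc m) _ _ entries))
    where
    entries : ∀ a b → a < suc m → b < suc m → reduced p a b ≡ A a b
    entries a b _ _ rewrite pf = trans (xor-identityʳ _) (trans (cong (A a b xor_) (∧-zeroʳ (A a (suc m)))) (xor-identityʳ (A a b)))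

  rk-firstPivot : x n ≡ false → q ≡ false → p ≡ true →
                  rk (suc n) A ≡ suc (suc (rk (suc m) (tridiag (λ i → x (suc i)) y)))
  rk-firstPivot xn qf pt = begin
    rk (suc n) A
      ≡⟨ rk-eliminate n n 0 A (n<1+n n) (s≤s z≤n) pt ⟩
    suc (rk n (λ a b → schur A n 0 (skip n a) (suc b)))
      ≡⟨ cong suc (rk-ext n _ B step₁) ⟩
    suc (rk n B)
      ≡⟨ cong suc (rk-eliminate (suc m) 0 (suc m) B (s≤s z≤n) (n<1+n _) pt) ⟩
    suc (suc (rk (suc m) (λ a b → schur B 0 (suc m) (suc a) (skip (suc m) b))))
      ≡⟨ cong (λ r → suc (suc r)) (rk-ext (suc m) _ _ step₂) ⟩
    suc (suc (rk (suc m) (tridiag (λ i → x (suc i)) y))) ∎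
    where
    open ≡-Reasoning
    B : ℕMat
    B a b = A a (suc b)
    border-inner : ∀ b → border m p q (suc b) ≡ false
    border-inner b rewrite qf = if-eta (b ≡ᵇ m)
    row-suc : ∀ b → b < n → A n (suc b) ≡ false
    row-suc b b< with m<1+n⇒m<n∨m≡n b<
    ... | inj₁ b<sm = trans (row (suc b) (s≤s b<sm)) (border-inner b)
    ... | inj₂ refl = trans corner xn
    step₁ : ∀ a b → a < n → b < n → schur A n 0 (skip n a) (suc b) ≡ B a b
    step₁ a b a< b< rewrite skip-< a< | row-suc b b< = trans (cong (A a (suc b) xor_) (∧-zeroʳ _)) (xor-identityʳ _)
    step₂ : ∀ a b → a < suc m → b < suc m → schur B 0 (suc m) (suc a) (skip (suc m) b) ≡ tridiag (λ i → x (suc i)) y a b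
    step₂ a b a< b< rewrite skip-< b< | column (suc a) (s≤s a<) | border-inner a =
      xor-identityʳ (A (suc a) (suc b))

reduced-both : (k : ℕ) (x y z : Seq) (a b : ℕ) → a < suc (suc k) → b < suc (suc k) →
  LastLine.reduced (suc k) x y z true a b ≡ arrow (tog x 0 (x (suc (suc k)))) y (tog z k (y k)) a b
reduced-both k x y z zero zero _ _ =
  trans (cancel (x 0) (z (suc k)) _) (cong (x 0 xor_) (tridiag-diag (λ i → x (suc i)) y (suc k)))
  where
  open xor-∧-Solver
  cancel : ∀ a c w → (a xor (c ∧ true)) xor (c xor (w ∧ true)) ≡ a xor w
  cancel = solve 3 (λ a c w → (a :+ (c :* con true)) :+ (c :+ (w :* con true)) := a :+ w) refl
reduced-both k x y z zero (suc b) _ (s≤s b<) = begin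
  (z b xor (z (suc k) ∧ false)) xor (t xor (w ∧ false))
    ≡⟨ cong₂ _xor_ (trans (cong (z b xor_) (∧-zeroʳ (z (suc k)))) (xor-identityʳ (z b))) (trans (cong (t xor_) (∧-zeroʳ w)) (xor-identityʳ t)) ⟩
  z b xor t
    ≡⟨ cong (z b xor_) (tridiag-below (λ i → x (suc i)) y k b b<) ⟩
  z b xor (if b ≡ᵇ k then y k else false)
    ≡⟨ xor-if (b ≡ᵇ k) (z b) (y k) ⟩
  tog z k (y k) b ∎
  where
  open ≡-Reasoning
  t w : Bool
  t = tridiag (λ i → x (suc i)) y (suc k) b
  w = tridiag (λ i → x (suc i)) y (suc k) (suc k)
reduced-both k x y z (suc a) zero (s≤s a<) _ = begin
  (z a xor (t ∧ true)) xor false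
    ≡⟨ trans (xor-identityʳ _) (cong (z a xor_) (∧-identityʳ t)) ⟩
  z a xor t
    ≡⟨ cong (z a xor_) (trans (tridiag-sym (λ i → x (suc i)) y a (suc k)) (tridiag-below (λ i → x (suc i)) y k a a<)) ⟩
  z a xor (if a ≡ᵇ k then y k else false)
    ≡⟨ xor-if (a ≡ᵇ k) (z a) (y k) ⟩
  tog z k (y k) a ∎
  where
  open ≡-Reasoning
  t : Bool
  t = tridiag (λ i → x (suc i)) y a (suc k)
reduced-both k x y z (suc a) (suc b) _ _ =
  trans (xor-identityʳ (t xor (u ∧ false))) (trans (cong (t xor_) (∧-zeroʳ u)) (xor-identityʳ t))
  where
  t u : Bool
  t = tridiag (λ i → x (suc i)) y a b
  u = tridiag (λ i → x (suc i)) y a (suc k)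

-- Sums over GF(2)^k

sumL-cong : {A : Set} {f g : A → ℕ} (xs : List A) → (∀ a → f a ≡ g a) → sumL f xs ≡ sumL g xs
sumL-cong [] e = refl
sumL-cong (x ∷ xs) e = cong₂ _+_ (e x) (sumL-cong xs e)

sumL-+ : {A : Set} (f g : A → ℕ) (xs : List A) → sumL (λ a → f a + g a) xs ≡ sumL f xs + sumL g xs
sumL-+ f g [] = refl
sumL-+ f g (x ∷ xs) rewrite sumL-+ f g xs = +-interchange (f x) (g x) (sumL f xs) (sumL g xs)

sumL-* : {A : Set} (c : ℕ) (f : A → ℕ) (xs : List A) → sumL (λ a → c * f a) xs ≡ c * sumL f xs
sumL-* c f [] = sym (*-zeroʳ c)
sumL-* c f (x ∷ xs) rewrite sumL-* c f xs = sym (*-distribˡ-+ c (f x) (sumL f xs))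

sumL-concatMap : {A B : Set} (f : B → ℕ) (g : A → List B) (xs : List A) →
                 sumL f (concatMap g xs) ≡ sumL (λ a → sumL f (g a)) xs
sumL-concatMap f g [] = refl
sumL-concatMap f g (x ∷ xs) =
  trans (sumL-++ (g x) (concatMap g xs)) (cong (sumL f (g x) +_) (sumL-concatMap f g xs))
  where
  sumL-++ : (us vs : List _) → sumL f (us ++ vs) ≡ sumL f us + sumL f vs
  sumL-++ [] vs = refl
  sumL-++ (u ∷ us) vs = trans (cong (f u +_) (sumL-++ us vs)) (sym (+-assoc (f u) _ _))

ΣBits : ℕ → (Seq → ℕ) → ℕ
ΣBits k g = sumL (λ v → g (at v)) (allBits k)

Respects : (Seq → ℕ) → Set
Respects g = ∀ {x x'} → x ≗ x' → g x ≡ g x'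

ΣBits-cong : (k : ℕ) {g h : Seq → ℕ} → (∀ x → g x ≡ h x) → ΣBits k g ≡ ΣBits k h
ΣBits-cong k e = sumL-cong (allBits k) (λ v → e (at v))

ΣBits-+ : (k : ℕ) (g h : Seq → ℕ) → ΣBits k (λ x → g x + h x) ≡ ΣBits k g + ΣBits k h
ΣBits-+ k g h = sumL-+ _ _ (allBits k)

ΣBits-* : (k c : ℕ) (g : Seq → ℕ) → ΣBits k (λ x → c * g x) ≡ c * ΣBits k g
ΣBits-* k c g = sumL-* c _ (allBits k)

both : (Bool → ℕ) → ℕ
both h = h false + h true

ΣBits-both : (k : ℕ) (h : Bool → Seq → ℕ) → ΣBits k (λ x → both (λ b → h b x)) ≡ both (λ b → ΣBits k (h b))
ΣBits-both k h = ΣBits-+ k (h false) (h true)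

cons : Bool → Seq → Seq
cons b x zero = b
cons b x (suc i) = x i

cons-cong : (a : Bool) {x x' : Seq} → x ≗ x' → cons a x ≗ cons a x'
cons-cong a e zero = refl
cons-cong a e (suc i) = e i

both-swap : (h : Bool → Bool → ℕ) → both (λ b → both (λ a → h b a)) ≡ both (λ a → both (λ b → h b a))
both-swap h = +-interchange (h false false) (h false true) (h true false) (h true true)

ΣBits-head : (k : ℕ) (g : Seq → ℕ) → Respects g → ΣBits (suc k) g ≡ ΣBits k (λ x → both (λ b → g (cons b x)))
ΣBits-head k g rg = trans (sumL-concatMap _ _ (allBits k)) (sumL-cong (allBits k) (λ v →
  cong₂ _+_ (rg (λ { zero → refl ; (suc i) → refl })) (trans (+-identityʳ _) (rg (λ { zero → refl ; (suc i) → refl })))))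

ΣBits-const : (k c : ℕ) → ΣBits k (λ _ → c) ≡ 2 ^ k * c
ΣBits-const zero c = refl
ΣBits-const (suc k) c = begin
  ΣBits (suc k) (λ _ → c)      ≡⟨ ΣBits-head k (λ _ → c) (λ _ → refl) ⟩
  ΣBits k (λ _ → c + c)        ≡⟨ ΣBits-const k (c + c) ⟩
  2 ^ k * (c + c)              ≡⟨ double (2 ^ k) c ⟩
  2 ^ suc k * c                ∎
  where
  open ≡-Reasoning
  double : ∀ a c → a * (c + c) ≡ (2 * a) * c
  double = solve-∀

upd : Seq → ℕ → Bool → Seq
upd x k b i = if i ≡ᵇ k then b else x i

ΣBits-last : (k : ℕ) (g : Seq → ℕ) → Respects g → ΣBits (suc k) g ≡ both (λ b → ΣBits k (λ x → g (upd x k b)))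
ΣBits-last zero g rg =
  trans (ΣBits-head zero g rg)
        (trans (+-identityʳ _) (cong₂ _+_ (trans (rg (λ { zero → refl ; (suc i) → refl })) (sym (+-identityʳ _)))
                                          (trans (rg (λ { zero → refl ; (suc i) → refl })) (sym (+-identityʳ _)))))
ΣBits-last (suc k) g rg = begin
  ΣBits (suc (suc k)) g
    ≡⟨ ΣBits-head (suc k) g rg ⟩
  ΣBits (suc k) (λ x → both (λ a → g (cons a x)))
    ≡⟨ ΣBits-last k _ (λ e → cong₂ _+_ (rg (cons-cong false e)) (rg (cons-cong true e))) ⟩
  both (λ b → ΣBits k (λ x → both (λ a → g (cons a (upd x k b)))))
    ≡⟨ cong₂ _+_ (ΣBits-both k (λ a x → g (cons a (upd x k false)))) (ΣBits-both k (λ a x → g (cons a (upd x k true)))) ⟩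
  both (λ b → both (λ a → ΣBits k (λ x → g (cons a (upd x k b)))))
    ≡⟨ both-swap (λ b a → ΣBits k (λ x → g (cons a (upd x k b)))) ⟩
  both (λ a → both (λ b → ΣBits k (λ x → g (cons a (upd x k b)))))
    ≡⟨ sym (cong₂ _+_ (ΣBits-both k (λ b x → g (cons false (upd x k b)))) (ΣBits-both k (λ b x → g (cons true (upd x k b))))) ⟩
  both (λ a → ΣBits k (λ x → both (λ b → g (cons a (upd x k b)))))
    ≡⟨ cong₂ _+_ (ΣBits-cong k (λ x → cong₂ _+_ (rg (commute false false x)) (rg (commute false true x))))
                 (ΣBits-cong k (λ x → cong₂ _+_ (rg (commute true false x)) (rg (commute true true x)))) ⟩
  both (λ a → ΣBits k (λ x → both (λ b → g (upd (cons a x) (suc k) b))))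
    ≡⟨ sym (ΣBits-both k (λ a x → both (λ b → g (upd (cons a x) (suc k) b)))) ⟩
  ΣBits k (λ x → both (λ a → both (λ b → g (upd (cons a x) (suc k) b))))
    ≡⟨ sym (ΣBits-head k _ (λ e → cong₂ _+_ (rg (upd-cong false e)) (rg (upd-cong true e)))) ⟩
  ΣBits (suc k) (λ x → both (λ b → g (upd x (suc k) b)))
    ≡⟨ ΣBits-both (suc k) (λ b x → g (upd x (suc k) b)) ⟩
  both (λ b → ΣBits (suc k) (λ x → g (upd x (suc k) b))) ∎
  where
  open ≡-Reasoning
  upd-cong : ∀ b {x x'} → x ≗ x' → upd x (suc k) b ≗ upd x' (suc k) b
  upd-cong b e i = cong (if i ≡ᵇ suc k then b else_) (e i)
  commute : ∀ a b x → cons a (upd x k b) ≗ upd (cons a x) (suc k) b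
  commute a b x zero = refl
  commute a b x (suc i) = refl

-- Toggling a coordinate is a bijection of GF(2)^k, so it does not change sums.
ΣBits-tog : (k i : ℕ) → i < k → (c : Bool) (g : Seq → ℕ) → Respects g →
            ΣBits k (λ x → g (tog x i c)) ≡ ΣBits k g
ΣBits-tog (suc k) zero _ c g rg = begin
  ΣBits (suc k) (λ x → g (tog x 0 c))
    ≡⟨ ΣBits-head k _ (λ e → rg (tog-cong 0 e refl)) ⟩
  ΣBits k (λ x → both (λ b → g (tog (cons b x) 0 c)))
    ≡⟨ ΣBits-cong k (λ x → cong₂ _+_ (rg (toggled false x)) (rg (toggled true x))) ⟩
  ΣBits k (λ x → g (cons c x) + g (cons (not c) x))
    ≡⟨ ΣBits-cong k (λ x → swap c x) ⟩
  ΣBits k (λ x → both (λ b → g (cons b x)))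
    ≡⟨ sym (ΣBits-head k g rg) ⟩
  ΣBits (suc k) g ∎
  where
  open ≡-Reasoning
  toggled : ∀ b x → tog (cons b x) 0 c ≗ cons (b xor c) x
  toggled b x zero = refl
  toggled b x (suc i) = refl
  swap : ∀ c x → g (cons c x) + g (cons (not c) x) ≡ both (λ b → g (cons b x))
  swap false x = refl
  swap true x = +-comm (g (cons true x)) _
ΣBits-tog (suc k) (suc i) (s≤s i<k) c g rg = begin
  ΣBits (suc k) (λ x → g (tog x (suc i) c))
    ≡⟨ ΣBits-head k _ (λ e → rg (tog-cong (suc i) e refl)) ⟩
  ΣBits k (λ x → both (λ b → g (tog (cons b x) (suc i) c)))
    ≡⟨ ΣBits-cong k (λ x → cong₂ _+_ (rg (commute false x)) (rg (commute true x))) ⟩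
  ΣBits k (λ x → both (λ b → g (cons b (tog x i c))))
    ≡⟨ ΣBits-both k (λ b x → g (cons b (tog x i c))) ⟩
  both (λ b → ΣBits k (λ x → g (cons b (tog x i c))))
    ≡⟨ cong₂ _+_ (ΣBits-tog k i i<k c _ (λ e → rg (cons-cong false e))) (ΣBits-tog k i i<k c _ (λ e → rg (cons-cong true e))) ⟩
  both (λ b → ΣBits k (λ x → g (cons b x)))
    ≡⟨ sym (ΣBits-both k (λ b x → g (cons b x))) ⟩
  ΣBits k (λ x → both (λ b → g (cons b x)))
    ≡⟨ sym (ΣBits-head k g rg) ⟩
  ΣBits (suc k) g ∎
  where
  open ≡-Reasoning
  commute : ∀ b x → tog (cons b x) (suc i) c ≗ cons b (tog x i c)
  commute b x zero = refl
  commute b x (suc j) = refl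

same : (x : Seq) → x ≗ x
same x i = refl

Σ³ : ℕ → ℕ → ℕ → (Seq → Seq → Seq → ℕ) → ℕ
Σ³ kz ky kx F = ΣBits kz (λ z → ΣBits ky (λ y → ΣBits kx (λ x → F x y z)))

Respects³ : (Seq → Seq → Seq → ℕ) → Set
Respects³ F = ∀ {x x' y y' z z'} → x ≗ x' → y ≗ y' → z ≗ z' → F x y z ≡ F x' y' z'

Σ³-cong : (kz ky kx : ℕ) {F G : Seq → Seq → Seq → ℕ} → (∀ x y z → F x y z ≡ G x y z) → Σ³ kz ky kx F ≡ Σ³ kz ky kx G
Σ³-cong kz ky kx e = ΣBits-cong kz (λ z → ΣBits-cong ky (λ y → ΣBits-cong kx (λ x → e x y z)))

Σ³-split : (kz ky kx : ℕ) (F : Seq → Seq → Seq → ℕ) → Respects³ F →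
  Σ³ (suc kz) (suc ky) (suc kx) F ≡
  both (λ bz → both (λ bx → both (λ by → Σ³ kz ky kx (λ x y z → F (upd x kx bx) (upd y ky by) (upd z kz bz)))))
Σ³-split kz ky kx F rF = begin
  Σ³ (suc kz) (suc ky) (suc kx) F
    ≡⟨ ΣBits-cong (suc kz) (λ z → ΣBits-cong (suc ky) (λ y → ΣBits-last kx (λ x → F x y z) (λ e → rF e (same y) (same z)))) ⟩
  ΣBits (suc kz) (λ z → ΣBits (suc ky) (λ y → both (λ bx → ΣBits kx (λ x → F (upd x kx bx) y z))))
    ≡⟨ ΣBits-cong (suc kz) (λ z → trans (ΣBits-both (suc ky) (λ bx y → ΣBits kx (λ x → F (upd x kx bx) y z))) (cong₂ _+_ (ΣBits-last ky _ (respects-y false z)) (ΣBits-last ky _ (respects-y true z)))) ⟩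
  ΣBits (suc kz) (λ z → both (λ bx → both (λ by → G bx by z)))
    ≡⟨ ΣBits-last kz _ (λ e → cong₂ _+_ (respects-z false e) (respects-z true e)) ⟩
  both (λ bz → ΣBits kz (λ z → both (λ bx → both (λ by → G bx by (upd z kz bz)))))
    ≡⟨ cong₂ _+_ (distribute false) (distribute true) ⟩
  both (λ bz → both (λ bx → both (λ by → Σ³ kz ky kx (λ x y z → F (upd x kx bx) (upd y ky by) (upd z kz bz))))) ∎
  where
  open ≡-Reasoning
  G : Bool → Bool → Seq → ℕ
  G bx by z = ΣBits ky (λ y → ΣBits kx (λ x → F (upd x kx bx) (upd y ky by) z))
  respects-y : ∀ bx z → Respects (λ y → ΣBits kx (λ x → F (upd x kx bx) y z))
  respects-y bx z e = ΣBits-cong kx (λ x → rF (same (upd x kx bx)) e (same z))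
  respects-z : ∀ bx {z z'} → z ≗ z' → both (λ by → G bx by z) ≡ both (λ by → G bx by z')
  respects-z bx e = cong₂ _+_ (ΣBits-cong ky (λ y → ΣBits-cong kx (λ x → rF (same (upd x kx bx)) (same (upd y ky false)) e)))
                              (ΣBits-cong ky (λ y → ΣBits-cong kx (λ x → rF (same (upd x kx bx)) (same (upd y ky true)) e)))
  distribute : ∀ bz → ΣBits kz (λ z → both (λ bx → both (λ by → G bx by (upd z kz bz)))) ≡
                      both (λ bx → both (λ by → ΣBits kz (λ z → G bx by (upd z kz bz))))
  distribute bz = trans (ΣBits-both kz (λ bx z → both (λ by → G bx by (upd z kz bz))))
                        (cong₂ _+_ (ΣBits-both kz (λ by z → G false by (upd z kz bz)))
                                   (ΣBits-both kz (λ by z → G true by (upd z kz bz))))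

Σ³-eightfold : (kz ky kx : ℕ) (F : Seq → Seq → Seq → ℕ) → Respects³ F → (c : ℕ) →
  (∀ bz bx by → Σ³ kz ky kx (λ x y z → F (upd x kx bx) (upd y ky by) (upd z kz bz)) ≡ c) →
  Σ³ (suc kz) (suc ky) (suc kx) F ≡ 8 * c
Σ³-eightfold kz ky kx F rF c e = trans (Σ³-split kz ky kx F rF) (eight (λ bz bx by → e bz bx by))
  where
  eight : {t : Bool → Bool → Bool → ℕ} → (∀ bz bx by → t bz bx by ≡ c) →
          both (λ bz → both (λ bx → both (λ by → t bz bx by))) ≡ 8 * c
  eight e rewrite e false false false | e false false true | e false true false | e false true true
                | e true false false | e true false true | e true true false | e true true true = octuple c
    where
    octuple : ∀ c → ((c + c) + (c + c)) + ((c + c) + (c + c)) ≡ 8 * c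
    octuple = solve-∀

Σ³-togX : (kz ky kx i : ℕ) → i < kx → (c : Bool) (F : Seq → Seq → Seq → ℕ) → Respects³ F →
          Σ³ kz ky kx (λ x y z → F (tog x i c) y z) ≡ Σ³ kz ky kx F
Σ³-togX kz ky kx i i< c F rF =
  ΣBits-cong kz (λ z → ΣBits-cong ky (λ y → ΣBits-tog kx i i< c (λ x → F x y z) (λ e → rF e (same y) (same z))))

Σ³-togZ : (kz ky kx i : ℕ) → i < kz → (c : Bool) (F : Seq → Seq → Seq → ℕ) → Respects³ F →
          Σ³ kz ky kx (λ x y z → F x y (tog z i c)) ≡ Σ³ kz ky kx F
Σ³-togZ kz ky kx i i< c F rF =
  ΣBits-tog kz i i< c _ (λ e → ΣBits-cong ky (λ y → ΣBits-cong kx (λ x → rF (same x) (same y) e)))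

-- Counting by rank

δ : ℕ → ℕ → ℕ
δ t r = if t ≡ᵇ r then 1 else 0

δ-suc : (t r : ℕ) → δ (suc t) r ≡ zP (δ t) r
δ-suc t zero = refl
δ-suc t (suc r) = refl

ΣBits-zero : (k : ℕ) → ΣBits k (λ _ → 0) ≡ 0
ΣBits-zero k = trans (ΣBits-const k 0) (*-zeroʳ (2 ^ k))

Σ²-zP : (ky kx : ℕ) (h : Seq → Seq → Poly) (r : ℕ) →
        ΣBits ky (λ y → ΣBits kx (λ x → zP (h x y) r)) ≡ zP (λ r' → ΣBits ky (λ y → ΣBits kx (λ x → h x y r'))) r
Σ²-zP ky kx h zero = trans (ΣBits-cong ky (λ y → ΣBits-zero kx)) (ΣBits-zero ky)
Σ²-zP ky kx h (suc r) = refl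

Σ³-zP : (kz ky kx : ℕ) (h : Seq → Seq → Seq → Poly) (r : ℕ) →
        Σ³ kz ky kx (λ x y z → zP (h x y z) r) ≡ zP (λ r' → Σ³ kz ky kx (λ x y z → h x y z r')) r
Σ³-zP kz ky kx h zero = trans (ΣBits-cong kz (λ z → Σ²-zP ky kx (λ x y → h x y z) zero)) (ΣBits-zero kz)
Σ³-zP kz ky kx h (suc r) = refl

zP-cong : {f g : Poly} → (∀ r → f r ≡ g r) → ∀ r → zP f r ≡ zP g r
zP-cong e zero = refl
zP-cong e (suc r) = e r

arrowCount : ℕ → Poly
arrowCount s r = Σ³ (s ∸ 1) (s ∸ 2) s (λ x y z → δ (rk s (arrow x y z)) r)

triCount : ℕ → Poly
triCount m r = ΣBits (m ∸ 1) (λ y → ΣBits m (λ x → δ (rk m (tridiag x y)) r))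

Σ³-δ2 : (kz ky kx : ℕ) (t : Seq → Seq → Seq → ℕ) (r : ℕ) →
        Σ³ kz ky kx (λ x y z → δ (suc (suc (t x y z))) r) ≡ zP (zP (λ r' → Σ³ kz ky kx (λ x y z → δ (t x y z) r'))) r
Σ³-δ2 kz ky kx t r = begin
  Σ³ kz ky kx (λ x y z → δ (suc (suc (t x y z))) r)
    ≡⟨ Σ³-cong kz ky kx (λ x y z → δ-suc (suc (t x y z)) r) ⟩
  Σ³ kz ky kx (λ x y z → zP (δ (suc (t x y z))) r)
    ≡⟨ Σ³-zP kz ky kx (λ x y z → δ (suc (t x y z))) r ⟩
  zP (λ r' → Σ³ kz ky kx (λ x y z → δ (suc (t x y z)) r')) r
    ≡⟨ zP-cong (λ r' → trans (Σ³-cong kz ky kx (λ x y z → δ-suc (t x y z) r')) (Σ³-zP kz ky kx (λ x y z → δ (t x y z)) r')) r ⟩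
  zP (zP (λ r' → Σ³ kz ky kx (λ x y z → δ (t x y z) r'))) r ∎
  where open ≡-Reasoning

at-toℕ : {k : ℕ} (X : Bits k) (i : Fin k) → at X (toℕ i) ≡ X i
at-toℕ {suc k} X fzero = refl
at-toℕ {suc k} X (fsuc i) = at-toℕ (λ t → X (fsuc t)) i

arrowMat-arrow : (s : ℕ) (X : Bits s) (Y : Bits (s ∸ 2)) (Z : Bits (s ∸ 1)) (i j : Fin s) →
                 arrowMat s X Y Z i j ≡ arrow (at X) (at Y) (at Z) (toℕ i) (toℕ j)
arrowMat-arrow s X Y Z i j with toℕ i in ei | toℕ j
... | zero | zero = trans (sym (at-toℕ X i)) (cong (at X) ei)
... | zero | suc b = refl
... | suc a | zero = refl
... | suc a | suc b = if-cong-then (a ≡ᵇ b) (trans (sym (at-toℕ X i)) (cong (at X) ei))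

triMat-tridiag : (m : ℕ) (X : Bits m) (Y : Bits (m ∸ 1)) (i j : Fin m) →
                 triMat m X Y i j ≡ tridiag (at X) (at Y) (toℕ i) (toℕ j)
triMat-tridiag m X Y i j with toℕ i in ei | toℕ j
... | a | b = if-cong-then (a ≡ᵇ b) (trans (sym (at-toℕ X i)) (cong (at X) ei))

Rpoly-arrowCount : (s : ℕ) → Rpoly s ≈P arrowCount s
Rpoly-arrowCount s r =
  sumL-cong (allBits (s ∸ 1)) (λ Z → sumL-cong (allBits (s ∸ 2)) (λ Y → sumL-cong (allBits s) (λ X →
    cong (λ t → δ t r) (rank-ext _ _ (arrowMat-arrow s X Y Z)))))

Lpoly-triCount : (m : ℕ) → Lpoly m ≈P triCount m
Lpoly-triCount m r =
  sumL-cong (allBits (m ∸ 1)) (λ Y → sumL-cong (allBits m) (λ X →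
    cong (λ t → δ t r) (rank-ext _ _ (triMat-tridiag m X Y))))

-- Locality of ranks of arrow matrices

upd-below : (x : Seq) (k : ℕ) (b : Bool) {i : ℕ} → i < k → upd x k b i ≡ x i
upd-below x k b i< = if-cong (≡ᵇ-≢ (<⇒≢ i<))

upd-at : (x : Seq) (k : ℕ) (b : Bool) → upd x k b k ≡ b
upd-at x k b = if-cong (≡ᵇ-refl k)

Agree : ℕ → Seq → Seq → Set
Agree s x x' = ∀ i → i < s → x i ≡ x' i

upd-agree : (x : Seq) (k : ℕ) (b : Bool) {s : ℕ} → s ≤ k → Agree s (upd x k b) x
upd-agree x k b s≤k i i< = upd-below x k b (≤-trans i< s≤k)

tog-agree : {s : ℕ} {x x' : Seq} {c c' : Bool} (k : ℕ) → Agree s x x' → c ≡ c' → Agree s (tog x k c) (tog x' k c')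
tog-agree k ex ec i i< = cong₂ (λ u d → if i ≡ᵇ k then u xor d else u) (ex i i<) ec

rk-arrow-upd : (s kx ky kz : ℕ) → s ≤ kx → s ≤ suc (suc ky) → s ≤ suc kz → (bx by bz : Bool) (x y z : Seq) →
               rk s (arrow (upd x kx bx) (upd y ky by) (upd z kz bz)) ≡ rk s (arrow x y z)
rk-arrow-upd s kx ky kz sx sy sz bx by bz x y z = rk-ext s _ _ (arrow-local s
  (upd-agree x kx bx sx)
  (λ i i< → upd-below y ky by (≤-pred (≤-pred (≤-trans i< sy))))
  (λ i i< → upd-below z kz bz (≤-pred (≤-trans i< sz))))

rk-respects : (s : ℕ) (f : ℕ → ℕ) → Respects³ (λ x y z → f (rk s (arrow x y z)))
rk-respects s f ex ey ez = cong f (rk-arrow-cong s ex ey ez)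

-- The recurrence

module Recurrence (k r : ℕ) where
  m n : ℕ
  m = suc k
  n = suc (suc m)

  F : Seq → Seq → Seq → ℕ
  F x y z = δ (rk (suc n) (arrow x y z)) r

  term : Bool → Bool → Bool → ℕ
  term bx by bz = Σ³ (suc m) m n (λ x y z → F (upd x n bx) (upd y m by) (upd z (suc m) bz))

  term-000 : term false false false ≡ arrowCount n r
  term-000 = Σ³-cong (suc m) m n (λ x y z → cong (λ t → δ t r)
    (trans (LastLine.rk-emptyLast m (upd x n false) (upd y m false) (upd z (suc m) false)
              (upd-at x n false) (upd-at z (suc m) false) (upd-at y m false))
           (rk-arrow-upd n n m (suc m) ≤-refl ≤-refl ≤-refl false false false x y z)))

  term-1 : ∀ by bz → term true by bz ≡ zP (arrowCount n) r
  term-1 by bz = begin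
    term true by bz
      ≡⟨ Σ³-cong (suc m) m n (λ x y z → cong (λ t → δ t r) (corner x y z)) ⟩
    Σ³ (suc m) m n (λ x y z → δ (suc (rk n (toggled x y z))) r)
      ≡⟨ trans (Σ³-cong (suc m) m n (λ x y z → δ-suc (rk n (toggled x y z)) r)) (Σ³-zP (suc m) m n (λ x y z → δ (rk n (toggled x y z))) r) ⟩
    zP (λ r' → Σ³ (suc m) m n (λ x y z → δ (rk n (toggled x y z)) r')) r
      ≡⟨ zP-cong untoggle r ⟩
    zP (arrowCount n) r ∎
    where
    open ≡-Reasoning
    toggled : Seq → Seq → Seq → ℕMat
    toggled x y z = arrow (tog (tog x 0 bz) (suc m) by) y (tog z m (bz ∧ by))
    corner : ∀ x y z → rk (suc n) (arrow (upd x n true) (upd y m by) (upd z (suc m) bz)) ≡ suc (rk n (toggled x y z))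
    corner x y z = trans (LastLine.rk-cornerPivot m (upd x n true) (upd y m by) (upd z (suc m) bz) (upd-at x n true))
      (cong suc (rk-ext n _ _ (arrow-local n
        (tog-agree (suc m) (tog-agree 0 (upd-agree x n true ≤-refl) (upd-at z (suc m) bz)) (upd-at y m by))
        (λ i i< → upd-below y m by (≤-pred (≤-pred i<)))
        (λ i i< → tog-agree m (upd-agree z (suc m) bz ≤-refl) (cong₂ _∧_ (upd-at z (suc m) bz) (upd-at y m by)) i (≤-pred i<)))))
    untoggle : ∀ r' → Σ³ (suc m) m n (λ x y z → δ (rk n (toggled x y z)) r') ≡ arrowCount n r'
    untoggle r' = begin
      Σ³ (suc m) m n (λ x y z → G (tog (tog x 0 bz) (suc m) by) y (tog z m (bz ∧ by)))
        ≡⟨ Σ³-togZ (suc m) m n m (n<1+n m) (bz ∧ by) _ (λ ex ey ez → rG (tog-cong (suc m) (tog-cong 0 ex refl) refl) ey ez) ⟩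
      Σ³ (suc m) m n (λ x y z → G (tog (tog x 0 bz) (suc m) by) y z)
        ≡⟨ Σ³-togX (suc m) m n (suc m) (n<1+n (suc m)) by _ (λ ex ey ez → rG (tog-cong 0 ex refl) ey ez) ⟩
      Σ³ (suc m) m n (λ x y z → G (tog x 0 bz) y z)
        ≡⟨ Σ³-togX (suc m) m n 0 (s≤s z≤n) bz G rG ⟩
      arrowCount n r' ∎
      where
      G : Seq → Seq → Seq → ℕ
      G x y z = δ (rk n (arrow x y z)) r'
      rG : Respects³ G
      rG = rk-respects n (λ t → δ t r')

  B : ℕ
  B = zP (zP (arrowCount (suc m))) r

  G : Seq → Seq → Seq → ℕ
  G x y z = δ (suc (suc (rk (suc m) (arrow x y z)))) r

  rG : Respects³ G
  rG = rk-respects (suc m) (λ t → δ (suc (suc t)) r)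

  eightfold : (G' : Seq → Seq → Seq → ℕ) → Respects³ G' →
    (∀ bz bx by → Σ³ m k (suc m) (λ x y z → G' (upd x (suc m) bx) (upd y k by) (upd z m bz)) ≡ Σ³ m k (suc m) G) →
    Σ³ (suc m) m n G' ≡ 8 * B
  eightfold G' rG' e = trans (Σ³-eightfold m k (suc m) G' rG' _ e)
                             (cong (8 *_) (Σ³-δ2 m k (suc m) (λ x y z → rk (suc m) (arrow x y z)) r))

  term-010 : term false true false ≡ 8 * B
  term-010 = trans (Σ³-cong (suc m) m n (λ x y z → cong (λ t → δ t r) (pivots x y z)))
                   (eightfold G rG (λ bz bx by → Σ³-cong m k (suc m) (λ x y z →
                      cong (λ t → δ (suc (suc t)) r) (rk-arrow-upd (suc m) (suc m) k m ≤-refl ≤-refl ≤-refl bx by bz x y z))))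
    where
    pivots : ∀ x y z → rk (suc n) (arrow (upd x n false) (upd y m true) (upd z (suc m) false)) ≡ suc (suc (rk (suc m) (arrow x y z)))
    pivots x y z = trans
      (LastLine.rk-subPivotOnly m (upd x n false) (upd y m true) (upd z (suc m) false)
         (upd-at x n false) (upd-at y m true) (upd-at z (suc m) false))
      (cong (λ t → suc (suc t)) (rk-arrow-upd (suc m) n m (suc m) (n≤1+n _) (n≤1+n _) (n≤1+n _) false true false x y z))

  term-011 : term false true true ≡ 8 * B
  term-011 = trans (Σ³-cong (suc m) m n (λ x y z → cong (λ t → δ t r) (pivots x y z)))
                   (eightfold G' rG' untoggle)
    where
    G' : Seq → Seq → Seq → ℕ
    G' x y z = G (tog x 0 (x (suc m))) y (tog z k (y k))
    rG' : Respects³ G'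
    rG' ex ey ez = rG (tog-cong 0 ex (ex (suc m))) ey (tog-cong k ez (ey k))
    pivots : ∀ x y z → rk (suc n) (arrow (upd x n false) (upd y m true) (upd z (suc m) true)) ≡
                       suc (suc (rk (suc m) (arrow (tog x 0 (x (suc m))) y (tog z k (y k)))))
    pivots x y z = begin
      rk (suc n) (arrow X Y Z)
        ≡⟨ LastLine.rk-subPivot m X Y Z (upd-at x n false) (upd-at y m true) ⟩
      suc (suc (rk (suc m) (LastLine.reduced m X Y Z (Z (suc m)))))
        ≡⟨ cong (λ c → suc (suc (rk (suc m) (LastLine.reduced m X Y Z c)))) (upd-at z (suc m) true) ⟩
      suc (suc (rk (suc m) (LastLine.reduced m X Y Z true)))
        ≡⟨ cong (λ t → suc (suc t)) (rk-ext (suc m) _ _ (reduced-both k X Y Z)) ⟩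
      suc (suc (rk (suc m) (arrow (tog X 0 (X (suc m))) Y (tog Z k (Y k)))))
        ≡⟨ cong (λ t → suc (suc t)) (rk-ext (suc m) _ _ (arrow-local (suc m)
             (tog-agree 0 (upd-agree x n false (n≤1+n _)) (upd-below x n false (n<1+n (suc m))))
             (λ i i< → upd-below y m true (m<n⇒m<1+n (≤-pred (≤-pred i<))))
             (λ i i< → tog-agree k (upd-agree z (suc m) true (n≤1+n m)) (upd-below y m true (n<1+n k)) i (≤-pred i<)))) ⟩
      suc (suc (rk (suc m) (arrow (tog x 0 (x (suc m))) y (tog z k (y k))))) ∎
      where
      open ≡-Reasoning
      X Y Z : Seq
      X = upd x n false
      Y = upd y m true
      Z = upd z (suc m) true
    untoggle : ∀ bz bx by → Σ³ m k (suc m) (λ x y z → G' (upd x (suc m) bx) (upd y k by) (upd z m bz)) ≡ Σ³ m k (suc m) G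
    untoggle bz bx by = begin
      Σ³ m k (suc m) (λ x y z → G' (upd x (suc m) bx) (upd y k by) (upd z m bz))
        ≡⟨ Σ³-cong m k (suc m) (λ x y z → cong (λ t → δ (suc (suc t)) r) (rk-ext (suc m) _ _ (arrow-local (suc m)
             (tog-agree 0 (upd-agree x (suc m) bx ≤-refl) (upd-at x (suc m) bx))
             (λ i i< → upd-below y k by (≤-pred (≤-pred i<)))
             (λ i i< → tog-agree k (upd-agree z m bz ≤-refl) (upd-at y k by) i (≤-pred i<))))) ⟩
      Σ³ m k (suc m) (λ x y z → G (tog x 0 bx) y (tog z k by))
        ≡⟨ Σ³-togZ m k (suc m) k (n<1+n k) by _ (λ ex ey ez → rG (tog-cong 0 ex refl) ey ez) ⟩
      Σ³ m k (suc m) (λ x y z → G (tog x 0 bx) y z)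
        ≡⟨ Σ³-togX m k (suc m) 0 (s≤s z≤n) bx G rG ⟩
      Σ³ m k (suc m) G ∎
      where open ≡-Reasoning

  D : ℕ
  D = zP (zP (triCount (suc m))) r

  term-001 : term false false true ≡ 2 ^ suc m * (2 * D)
  term-001 = begin
    term false false true
      ≡⟨ Σ³-cong (suc m) m n (λ x y z → cong (λ t → δ t r) (pivots x y z)) ⟩
    ΣBits (suc m) (λ z → ΣBits m (λ y → ΣBits n (λ x → H (λ i → x (suc i)) y)))
      ≡⟨ ΣBits-cong (suc m) (λ z → ΣBits-cong m (λ y → drop-x₀ y)) ⟩
    ΣBits (suc m) (λ z → ΣBits m (λ y → 2 * ΣBits (suc m) (λ x → H x y)))
      ≡⟨ ΣBits-cong (suc m) (λ z → ΣBits-* m 2 (λ y → ΣBits (suc m) (λ x → H x y))) ⟩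
    ΣBits (suc m) (λ z → 2 * ΣBits m (λ y → ΣBits (suc m) (λ x → H x y)))
      ≡⟨ ΣBits-const (suc m) _ ⟩
    2 ^ suc m * (2 * ΣBits m (λ y → ΣBits (suc m) (λ x → H x y)))
      ≡⟨ cong (λ t → 2 ^ suc m * (2 * t)) shift ⟩
    2 ^ suc m * (2 * D) ∎
    where
    open ≡-Reasoning
    H : Seq → Seq → ℕ
    H x y = δ (suc (suc (rk (suc m) (tridiag x y)))) r
    pivots : ∀ x y z → rk (suc n) (arrow (upd x n false) (upd y m false) (upd z (suc m) true)) ≡
                       suc (suc (rk (suc m) (tridiag (λ i → x (suc i)) y)))
    pivots x y z = trans
      (LastLine.rk-firstPivot m (upd x n false) (upd y m false) (upd z (suc m) true)
         (upd-at x n false) (upd-at y m false) (upd-at z (suc m) true))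
      (cong (λ t → suc (suc t)) (rk-ext (suc m) _ _ (tridiag-local (suc m)
         (λ i i< → upd-below x n false (s≤s i<)) (λ i i< → upd-below y m false (≤-pred i<)))))
    -- the entry x₀ is not read: summing over it doubles
    drop-x₀ : ∀ y → ΣBits n (λ x → H (λ i → x (suc i)) y) ≡ 2 * ΣBits (suc m) (λ x → H x y)
    drop-x₀ y = trans (ΣBits-head (suc m) _ (λ e → cong (λ t → δ (suc (suc t)) r) (rk-tridiag-cong (suc m) (λ i → e (suc i)) (same y))))
                      (trans (ΣBits-+ (suc m) (λ x → H x y) (λ x → H x y)) (double (ΣBits (suc m) (λ x → H x y))))
      where
      double : ∀ a → a + a ≡ 2 * a
      double = solve-∀
    shift : ΣBits m (λ y → ΣBits (suc m) (λ x → H x y)) ≡ D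
    shift = begin
      ΣBits m (λ y → ΣBits (suc m) (λ x → H x y))
        ≡⟨ ΣBits-cong m (λ y → ΣBits-cong (suc m) (λ x → δ-suc (suc (rk (suc m) (tridiag x y))) r)) ⟩
      ΣBits m (λ y → ΣBits (suc m) (λ x → zP (δ (suc (rk (suc m) (tridiag x y)))) r))
        ≡⟨ Σ²-zP m (suc m) (λ x y → δ (suc (rk (suc m) (tridiag x y)))) r ⟩
      zP (λ r' → ΣBits m (λ y → ΣBits (suc m) (λ x → δ (suc (rk (suc m) (tridiag x y))) r'))) r
        ≡⟨ zP-cong (λ r' → trans (ΣBits-cong m (λ y → ΣBits-cong (suc m) (λ x → δ-suc (rk (suc m) (tridiag x y)) r')))
                                 (Σ²-zP m (suc m) (λ x y → δ (rk (suc m) (tridiag x y))) r')) r ⟩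
      D ∎

  recurrence : arrowCount (suc n) r ≡ ((4 * zP (arrowCount n) r + arrowCount n r) + 16 * B) + 2 ^ n * D
  recurrence = begin
    arrowCount (suc n) r
      ≡⟨ Σ³-split (suc m) m n F (rk-respects (suc n) (λ t → δ t r)) ⟩
    both (λ bz → both (λ bx → both (λ by → term bx by bz)))
      ≡⟨ cong₂ _+_ (cong₂ _+_ (cong₂ _+_ term-000 term-010) (cong₂ _+_ (term-1 false false) (term-1 true false)))
                   (cong₂ _+_ (cong₂ _+_ term-001 term-011) (cong₂ _+_ (term-1 false true) (term-1 true true))) ⟩
    ((R + 8 * B) + (zR + zR)) + ((2 ^ suc m * (2 * D) + 8 * B) + (zR + zR))
      ≡⟨ collect R zR B D (2 ^ suc m) ⟩
    ((4 * zR + R) + 16 * B) + 2 ^ n * D ∎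
    where
    open ≡-Reasoning
    R zR : ℕ
    R = arrowCount n r
    zR = zP (arrowCount n) r
    collect : ∀ R zR B D P → ((R + 8 * B) + (zR + zR)) + ((P * (2 * D) + 8 * B) + (zR + zR)) ≡
                             ((4 * zR + R) + 16 * B) + (2 * P) * D
    collect = solve-∀

Rpoly-recurrence : (n : ℕ) → 3 ≤ n →
  Rpoly (suc n) ≈P (4 · zP (Rpoly n) ⊕ Rpoly n) ⊕ 16 · zP (zP (Rpoly (n ∸ 1))) ⊕ (2 ^ n) · zP (zP (Lpoly (n ∸ 1)))
Rpoly-recurrence (suc (suc (suc k))) (s≤s (s≤s (s≤s _))) r = begin
  Rpoly (suc n) r
    ≡⟨ Rpoly-arrowCount (suc n) r ⟩
  arrowCount (suc n) r
    ≡⟨ Recurrence.recurrence k r ⟩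
  ((4 * zP (arrowCount n) r + arrowCount n r) + 16 * zP (zP (arrowCount (n ∸ 1))) r) + 2 ^ n * zP (zP (triCount (n ∸ 1))) r
    ≡⟨ sym (cong₂ _+_ (cong₂ _+_ (cong₂ _+_ (cong (4 *_) (zP-cong (Rpoly-arrowCount n) r)) (Rpoly-arrowCount n r))
                                 (cong (16 *_) (zP-cong (zP-cong (Rpoly-arrowCount (n ∸ 1))) r)))
                      (cong (2 ^ n *_) (zP-cong (zP-cong (Lpoly-triCount (n ∸ 1))) r))) ⟩
  ((4 * zP (Rpoly n) r + Rpoly n r) + 16 * zP (zP (Rpoly (n ∸ 1))) r) + 2 ^ n * zP (zP (Lpoly (n ∸ 1))) r ∎
  where
  open ≡-Reasoning
  n : ℕ
  n = suc (suc (suc k))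

Rpoly-2 : Rpoly 2 ≈P fromCoeffs (1 ∷ 3 ∷ 4 ∷ [])
Rpoly-2 zero = refl
Rpoly-2 (suc zero) = refl
Rpoly-2 (suc (suc zero)) = refl
Rpoly-2 (suc (suc (suc j))) = refl

Rpoly-3 : Rpoly 3 ≈P fromCoeffs (1 ∷ 7 ∷ 28 ∷ 28 ∷ [])
Rpoly-3 zero = refl
Rpoly-3 (suc zero) = refl
Rpoly-3 (suc (suc zero)) = refl
Rpoly-3 (suc (suc (suc zero))) = refl
Rpoly-3 (suc (suc (suc (suc j)))) = refl

mainTheorem5 : ((n : ℕ) → 3 ≤ n →
    Rpoly (suc n) ≈P (4 · zP (Rpoly n) ⊕ Rpoly n)
    ⊕ 16 · zP (zP (Rpoly (n ∸ 1)))
    ⊕ (2 ^ n) · zP (zP (Lpoly (n ∸ 1))))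
    × (Rpoly 2 ≈P fromCoeffs (1 ∷ 3 ∷ 4 ∷ []))
    × (Rpoly 3 ≈P fromCoeffs (1 ∷ 7 ∷ 28 ∷ 28 ∷ []))
mainTheorem5 = Rpoly-recurrence , Rpoly-2 , Rpoly-3
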